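{- Let $n\geq 2$ be an integer written as $n=p2^{q}$ with $p$ odd and $q\geq 0$. Then $K_{2n}\square C_{2n}$ is interval colorable and $$W(K_{2n}\square C_{2n})\geq 2n^{2}+4n-1-p-q.$$
   Context: All graphs are finite, undirected, without loops or multiple edges. An edge-coloring of a graph $G$ with colors $1,\ldots,t$ is an interval $t$-coloring if all $t$ colors are used, and the colors of the edges incident to each vertex are distinct and form an interval of consecutive integers. A graph is interval colorable if it has an interval $t$-coloring for some positive integer $t$; for such a graph, $W(G)$ is the greatest such $t$. $K_{2n}$ is the complete graph on $2n$ vertices, $C_{2n}$ the cycle on $2n$ vertices. The Cartesian product $G\square H$ has vertex set $V(G)\times V(H)$, with $(u_1,v_1)(u_2,v_2)$ an edge iff either $u_1=u_2$ and $v_1v_2\in E(H)$, or $v_1=v_2$ and $u_1u_2\in E(G)$. -}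

module Defs where

open import Data.Nat using (ℕ; zero; suc; _+_; _*_; _≤_)
open import Data.Fin using (Fin; toℕ)
open import Data.Product using (Σ; ∃; ∃-syntax; _×_; _,_)
open import Data.Sum using (_⊎_)
open import Relation.Binary.PropositionalEquality using (_≡_; _≢_)
open import Relation.Nullary using (¬_)
open import Function.Bundles using (_⇔_)

record Graph : Set₁ where
  field
    V   : Set
    Adj : V → V → Set
open Graph public

K : ℕ → Graph
K m = record { V = Fin m ; Adj = λ i j → i ≢ j }

-- Cycle C_m on vertex set Fin m: i ~ j iff j = i+1 or i = j+1 (mod m),
-- written without mod: i ~ i+1, and the wrap-around edge m-1 ~ 0.
CycleStep : (m : ℕ) → Fin m → Fin m → Set
CycleStep m i j = (suc (toℕ i) ≡ toℕ j) ⊎ ((suc (toℕ i) ≡ m) × (toℕ j ≡ 0))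

C : ℕ → Graph
C m = record { V = Fin m ; Adj = λ i j → CycleStep m i j ⊎ CycleStep m j i }

_□_ : Graph → Graph → Graph
G □ H = record
  { V   = V G × V H
  ; Adj = λ { (u₁ , v₁) (u₂ , v₂) →
              ((u₁ ≡ u₂) × Adj H v₁ v₂) ⊎ ((v₁ ≡ v₂) × Adj G u₁ u₂) } }

IntervalColoring : Graph → ℕ → Set
IntervalColoring G t =
  Σ (V G → V G → ℕ) λ c →
    (∀ u v → Adj G u v → c u v ≡ c v u)
  × (∀ u v → Adj G u v → (1 ≤ c u v) × (c u v ≤ t))
  × (∀ k → 1 ≤ k → k ≤ t → ∃[ u ] ∃[ v ] (Adj G u v × (c u v ≡ k)))
  × (∀ v u w → Adj G v u → Adj G v w → c v u ≡ c v w → u ≡ w)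
  × (∀ v → ∃[ a ] ∃[ b ] (∀ k → (∃[ u ] (Adj G v u × (c v u ≡ k))) ⇔ ((a ≤ k) × (k ≤ b))))

IntervalColorable : Graph → Set
IntervalColorable G = ∃[ t ] ((1 ≤ t) × IntervalColoring G t)

-- "W(G) ≥ m" for an interval colorable G: since W(G) is the greatest t with
-- an interval t-coloring, W(G) ≥ m iff some interval t-coloring has t ≥ m.
W≥ : Graph → ℕ → Set
W≥ G m = ∃[ t ] ((m ≤ t) × IntervalColoring G t)

Odd : ℕ → Set
Odd p = ∃[ k ] (p ≡ suc (2 * k))

module Submission where

-- The proof constructs an interval colouring with that many colours.
--  * A window colouring of a complete graph is an interval colouring in
--    which the interval of colours at every vertex is kept as data.  Such
--    colourings can be moved along bijections, and their windows cover all
--    colours.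
--  * Spans of complete graphs: an explicit colouring of K_{2p} with 3p − 2
--    colours (BaseColouring) and a doubling step K_{2n} ↦ K_{4n} adding
--    4n − 1 colours (Doubling) give, for n = p · 2^q, a window colouring of
--    K_{2n} with t ≥ 4n − 2 − p − q colours (large).
--  * The product with the cycle (CycleProduct): along C_{2n} the copies of
--    that colouring are shifted up by 2n per step for half of the cycle and
--    back down for the other half, and each cycle edge gets a colour just
--    outside the windows of its ends; this yields an interval colouring of
--    K_{2n} □ C_{2n} with t + 2n² + 1 colours.

open import Defs
open import Data.Nat using (ℕ; zero; suc; pred; _+_; _*_; _∸_; _^_; _≤_; _<_; z≤n; s≤s; s≤s⁻¹; _≤?_; _<?_)
open import Data.Nat.Properties
open import Data.Nat.Tactic.RingSolver using (solve-∀)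
open import Data.Fin using (Fin; zero; suc; toℕ; fromℕ; fromℕ<) renaming (_≟_ to _≟ᶠ_)
open import Data.Fin.Properties using (toℕ<n; toℕ-injective; toℕ-fromℕ; toℕ-fromℕ<; +↔⊎)
open import Data.Product using (Σ; ∃-syntax; _×_; _,_; proj₁; proj₂)
open import Data.Sum using (_⊎_; inj₁; inj₂)
open import Data.Sum.Function.Propositional using (_⊎-↔_)
open import Data.Empty using (⊥-elim)
open import Function.Bundles using (_↔_; _⇔_; Inverse; mk⇔; mk↔ₛ′)
open import Function.Properties.Inverse using (↔-refl; ↔-trans)
open import Relation.Binary.Definitions using (DecidableEquality)
open import Relation.Binary.PropositionalEquality
open import Relation.Nullary using (yes; no; Dec)

≤-≡ : ∀ {a b c} → a ≤ b → b ≡ c → a ≤ c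
≤-≡ p refl = p

≡-≤ : ∀ {a b c} → a ≡ b → b ≤ c → a ≤ c
≡-≤ refl p = p

+≡⇒≤ : ∀ a k {b} → a + k ≡ b → a ≤ b
+≡⇒≤ a k eq = ≤-≡ (m≤m+n a k) eq

infix 4 _∈[_,+_]
_∈[_,+_] : ℕ → ℕ → ℕ → Set
z ∈[ a ,+ w ] = (a ≤ z) × (z ≤ a + w)

-- This is an
-- interval t-colouring of K_{d+2}, with the windows kept as explicit data.
record WindowColouring (V : Set) (d t : ℕ) : Set where
  field
    col      : V → V → ℕ
    st       : V → ℕ
    col-sym  : ∀ u v → u ≢ v → col u v ≡ col v u
    proper   : ∀ v u w → v ≢ u → v ≢ w → col v u ≡ col v w → u ≡ w
    col≥st   : ∀ v u → v ≢ u → st v ≤ col v u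
    col≤st+d : ∀ v u → v ≢ u → col v u ≤ st v + d
    onto     : ∀ v x → st v ≤ x → x ≤ st v + d → Σ V λ u → (v ≢ u) × (col v u ≡ x)
    st≥1     : ∀ v → 1 ≤ st v
    st+d≤t   : ∀ v → st v + d ≤ t
    bottom   : Σ V λ v → st v ≡ 1
    top      : Σ V λ v → st v + d ≡ t

  private
    b w : V
    b = proj₁ bottom
    w = proj₁ top
    st-b : st b ≡ 1
    st-b = proj₂ bottom
    st-w+d : st w + d ≡ t
    st-w+d = proj₂ top

  -- Every colour of [1, t] lies in some window: the bottom window and the
  -- top window share the colour of the edge joining their vertices, so
  -- together they cover [1, t].
  covers : ∀ x → 1 ≤ x → x ≤ t → Σ V λ v → x ∈[ st v ,+ d ]
  covers x 1≤x x≤t with x ≤? 1 + d | st w ≤? x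
  ... | yes x≤1+d | _          = b , ≡-≤ st-b 1≤x , ≤-≡ x≤1+d (cong (_+ d) (sym st-b))
  ... | no _      | yes st-w≤x = w , st-w≤x , ≤-≡ x≤t (sym st-w+d)
  ... | no x≰1+d  | no st-w≰x  = ⊥-elim (<-irrefl refl (begin-strict
            col b w       ≤⟨ col≤st+d b w b≢w ⟩
            st b + d      ≡⟨ cong (_+ d) st-b ⟩
            1 + d         <⟨ 1+d<st-w ⟩
            st w          ≤⟨ col≥st w b (≢-sym b≢w) ⟩
            col w b       ≡⟨ col-sym w b (≢-sym b≢w) ⟩
            col b w       ∎))
    where
    open ≤-Reasoning
    1+d<st-w : 1 + d < st w
    1+d<st-w = <-trans (≰⇒> x≰1+d) (≰⇒> st-w≰x)
    b≢w : b ≢ w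
    b≢w b≡w = <⇒≢ (≤-trans (s≤s (s≤s z≤n)) 1+d<st-w) (trans (sym st-b) (cong st b≡w))

  -- Widening every window by two colours at the top, the windows cover
  -- [1, t + 2]; the two extra colours are taken care of by the top window.
  covers⁺ : ∀ y → 1 ≤ y → y ≤ t + 2 → Σ V λ v → y ∈[ st v ,+ suc (suc d) ]
  covers⁺ y 1≤y y≤t+2 with y ≤? t
  ... | yes y≤t with covers y 1≤y y≤t
  ...   | v , l , h = v , l , ≤-trans h (+-monoʳ-≤ (st v) (≤-trans (n≤1+n d) (n≤1+n _)))
  covers⁺ y 1≤y y≤t+2 | no y≰t = w , st-w≤y , ≤-≡ y≤t+2 t+2≡
    where
    st-w≤y : st w ≤ y
    st-w≤y = ≤-trans (m≤m+n (st w) d) (≤-trans (≤-reflexive st-w+d) (<⇒≤ (≰⇒> y≰t)))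
    t+2≡ : t + 2 ≡ st w + suc (suc d)
    t+2≡ = trans (cong (_+ 2) (sym st-w+d)) (identity (st w) d)
      where
      identity : ∀ a d → a + d + 2 ≡ a + suc (suc d)
      identity = solve-∀

transport : ∀ {A B : Set} {d t} → A ↔ B → WindowColouring B d t → WindowColouring A d t
transport {A} {B} {d} {t} A↔B W = record
  { col      = λ a a′ → col (to a) (to a′)
  ; st       = λ a → st (to a)
  ; col-sym  = λ u v u≢v → col-sym (to u) (to v) (to-≢ u≢v)
  ; proper   = λ v u w v≢u v≢w e → to-injective (proper (to v) (to u) (to w) (to-≢ v≢u) (to-≢ v≢w) e)
  ; col≥st   = λ v u v≢u → col≥st (to v) (to u) (to-≢ v≢u)
  ; col≤st+d = λ v u v≢u → col≤st+d (to v) (to u) (to-≢ v≢u)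
  ; onto     = onto′
  ; st≥1     = λ v → st≥1 (to v)
  ; st+d≤t   = λ v → st+d≤t (to v)
  ; bottom   = from (proj₁ bottom) , trans (cong st (strictlyInverseˡ _)) (proj₂ bottom)
  ; top      = from (proj₁ top) , trans (cong (λ b → st b + d) (strictlyInverseˡ _)) (proj₂ top)
  }
  where
  open WindowColouring W
  open Inverse A↔B using (to; from; strictlyInverseˡ; strictlyInverseʳ)
  to-injective : ∀ {a a′} → to a ≡ to a′ → a ≡ a′
  to-injective {a} {a′} e = trans (sym (strictlyInverseʳ a)) (trans (cong from e) (strictlyInverseʳ a′))
  to-≢ : ∀ {a a′} → a ≢ a′ → to a ≢ to a′
  to-≢ a≢a′ e = a≢a′ (to-injective e)
  onto′ : ∀ v x → st (to v) ≤ x → x ≤ st (to v) + d → Σ A λ u → (v ≢ u) × (col (to v) (to u) ≡ x)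
  onto′ v x l h with onto (to v) x l h
  ... | b , v≢b , e = from b , (λ v≡ → v≢b (trans (cong to v≡) (strictlyInverseˡ b)))
                             , trans (cong (col (to v)) (strictlyInverseˡ b)) e

K₂-colouring : WindowColouring (Fin 2) 0 1
K₂-colouring = record
  { col = λ _ _ → 1 ; st = λ _ → 1
  ; col-sym = λ _ _ _ → refl ; proper = proper
  ; col≥st = λ _ _ _ → ≤-refl ; col≤st+d = λ _ _ _ → ≤-refl
  ; onto = onto
  ; st≥1 = λ _ → ≤-refl ; st+d≤t = λ _ → ≤-refl
  ; bottom = zero , refl ; top = zero , refl }
  where
  other : Fin 2 → Fin 2
  other zero = suc zero
  other (suc _) = zero
  other-unique : ∀ v u → v ≢ u → u ≡ other v
  other-unique zero zero v≢u = ⊥-elim (v≢u refl)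
  other-unique zero (suc zero) _ = refl
  other-unique (suc zero) zero _ = refl
  other-unique (suc zero) (suc zero) v≢u = ⊥-elim (v≢u refl)
  proper : ∀ (v u w : Fin 2) → v ≢ u → v ≢ w → 1 ≡ 1 → u ≡ w
  proper v u w v≢u v≢w _ = trans (other-unique v u v≢u) (sym (other-unique v w v≢w))
  onto : ∀ (v : Fin 2) x → 1 ≤ x → x ≤ 1 + 0 → Σ (Fin 2) λ u → (v ≢ u) × (1 ≡ x)
  onto zero x l h = suc zero , (λ ()) , ≤-antisym l h
  onto (suc zero) x l h = zero , (λ ()) , ≤-antisym l h

-- From a window colouring of K on V (window width d, so each
-- vertex has D = d + 1 colours) build one of K on two copies V ⊎ V:
-- the first copy keeps its colours, the second copy is shifted up by
-- 2D + 1, an edge x₁y₂ (x ≢ y) gets col x y + D and the edge x₁x₂ gets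
-- st x + 2D.  The new windows are [st x, st x + 2D] on the first copy and
-- [st x + D, st x + 3D] on the second; the total span grows by 2D + 1.
module Doubling {V : Set} (_≟_ : DecidableEquality V) {d t : ℕ} (W : WindowColouring V d t) where
  open WindowColouring W
  open ≤-Reasoning

  D : ℕ
  D = suc d

  col<st+D : ∀ x y → x ≢ y → col x y < st x + D
  col<st+D x y x≢y = ≤-≡ (s≤s (col≤st+d x y x≢y)) (sym (+-suc (st x) d))

  cross : V → V → ℕ
  cross x y with x ≟ y
  ... | yes _ = st x + (D + D)
  ... | no _  = col x y + D

  cross-diag : ∀ x → cross x x ≡ st x + (D + D)
  cross-diag x with x ≟ x
  ... | yes _ = refl
  ... | no x≢x = ⊥-elim (x≢x refl)

  cross-off : ∀ x y → x ≢ y → cross x y ≡ col x y + D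
  cross-off x y x≢y with x ≟ y
  ... | yes x≡y = ⊥-elim (x≢y x≡y)
  ... | no _ = refl

  cross-sym : ∀ x y → cross x y ≡ cross y x
  cross-sym x y with x ≟ y | y ≟ x
  ... | yes x≡y | yes _   = cong (λ z → st z + (D + D)) x≡y
  ... | yes x≡y | no y≢x  = ⊥-elim (y≢x (sym x≡y))
  ... | no x≢y  | yes y≡x = ⊥-elim (x≢y (sym y≡x))
  ... | no x≢y  | no _    = cong (_+ D) (col-sym x y x≢y)

  cross≥ : ∀ x y → st x + D ≤ cross x y
  cross≥ x y with x ≟ y
  ... | yes _ = +-monoʳ-≤ (st x) (m≤m+n D D)
  ... | no x≢y = +-monoˡ-≤ D (col≥st x y x≢y)

  cross≤ : ∀ x y → cross x y ≤ st x + (D + D)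
  cross≤ x y with x ≟ y
  ... | yes _ = ≤-refl
  ... | no x≢y = begin
    col x y + D      ≤⟨ +-monoˡ-≤ D (<⇒≤ (col<st+D x y x≢y)) ⟩
    st x + D + D     ≡⟨ +-assoc (st x) D D ⟩
    st x + (D + D)   ∎

  cross-injective : ∀ x y y′ → cross x y ≡ cross x y′ → y ≡ y′
  cross-injective x y y′ e with x ≟ y | x ≟ y′
  ... | yes x≡y | yes x≡y′ = trans (sym x≡y) x≡y′
  ... | yes _   | no x≢y′  = ⊥-elim (<⇒≢ (col<st+D x y′ x≢y′)
                               (sym (+-cancelʳ-≡ D _ _ (trans (+-assoc (st x) D D) e))))
  ... | no x≢y  | yes _    = ⊥-elim (<⇒≢ (col<st+D x y x≢y)
                               (+-cancelʳ-≡ D _ _ (trans e (sym (+-assoc (st x) D D)))))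
  ... | no x≢y  | no x≢y′  = proper x y y′ x≢y x≢y′ (+-cancelʳ-≡ D _ _ e)

  cross-onto : ∀ x z → st x + D ≤ z → z ≤ st x + D + D → Σ V λ y → cross x y ≡ z
  cross-onto x z l h with m≤n⇒∃[o]m+o≡n l
  ... | e , refl with m≤n⇒m<n∨m≡n (+-cancelˡ-≤ (st x + D) e D h)
  ...   | inj₂ refl = x , trans (cross-diag x) (sym (+-assoc (st x) D D))
  ...   | inj₁ (s≤s e≤d) with onto x (st x + e) (m≤m+n (st x) e) (+-monoʳ-≤ (st x) e≤d)
  ...     | y , x≢y , col≡ = y , (begin-equality
    cross x y     ≡⟨ cross-off x y x≢y ⟩
    col x y + D   ≡⟨ cong (_+ D) col≡ ⟩
    st x + e + D  ≡⟨ +-assoc (st x) e D ⟩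
    st x + (e + D) ≡⟨ cong (st x +_) (+-comm e D) ⟩
    st x + (D + e) ≡⟨ sym (+-assoc (st x) D e) ⟩
    st x + D + e  ∎)

  S : ℕ
  S = D + suc D

  col² : V ⊎ V → V ⊎ V → ℕ
  col² (inj₁ x) (inj₁ y) = col x y
  col² (inj₂ x) (inj₂ y) = col x y + S
  col² (inj₁ x) (inj₂ y) = cross x y
  col² (inj₂ x) (inj₁ y) = cross y x

  st² : V ⊎ V → ℕ
  st² (inj₁ x) = st x
  st² (inj₂ x) = st x + D

  underlying : V ⊎ V → V
  underlying (inj₁ x) = x
  underlying (inj₂ x) = x

  ≢₁ : ∀ {x y : V} → inj₁ {B = V} x ≢ inj₁ y → x ≢ y
  ≢₁ ne e = ne (cong inj₁ e)

  ≢₂ : ∀ {x y : V} → inj₂ {A = V} x ≢ inj₂ y → x ≢ y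
  ≢₂ ne e = ne (cong inj₂ e)

  second-top : ∀ x → st x + D + (D + D) ≡ st x + d + S
  second-top x = identity (st x) d
    where
    identity : ∀ a d → a + suc d + (suc d + suc d) ≡ a + d + (suc d + suc (suc d))
    identity = solve-∀

  col²-sym : ∀ u v → u ≢ v → col² u v ≡ col² v u
  col²-sym (inj₁ x) (inj₁ y) ne = col-sym x y (≢₁ ne)
  col²-sym (inj₁ x) (inj₂ y) _  = refl
  col²-sym (inj₂ x) (inj₁ y) _  = refl
  col²-sym (inj₂ x) (inj₂ y) ne = cong (_+ S) (col-sym x y (≢₂ ne))

  col²≥st² : ∀ v u → v ≢ u → st² v ≤ col² v u
  col²≥st² (inj₁ x) (inj₁ y) ne = col≥st x y (≢₁ ne)
  col²≥st² (inj₁ x) (inj₂ y) _  = ≤-trans (m≤m+n (st x) D) (cross≥ x y)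
  col²≥st² (inj₂ x) (inj₁ y) _  = ≤-≡ (cross≥ x y) (cross-sym x y)
  col²≥st² (inj₂ x) (inj₂ y) ne = +-mono-≤ (col≥st x y (≢₂ ne)) (m≤m+n D (suc D))

  col²≤st²+2D : ∀ v u → v ≢ u → col² v u ≤ st² v + (D + D)
  col²≤st²+2D (inj₁ x) (inj₁ y) ne = ≤-trans (col≤st+d x y (≢₁ ne)) (+-monoʳ-≤ (st x) (≤-trans (n≤1+n d) (m≤m+n D D)))
  col²≤st²+2D (inj₁ x) (inj₂ y) _  = cross≤ x y
  col²≤st²+2D (inj₂ x) (inj₁ y) _  = begin
    cross y x          ≡⟨ cross-sym y x ⟩
    cross x y          ≤⟨ cross≤ x y ⟩
    st x + (D + D)     ≤⟨ +-monoˡ-≤ (D + D) (m≤m+n (st x) D) ⟩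
    st x + D + (D + D) ∎
  col²≤st²+2D (inj₂ x) (inj₂ y) ne = begin
    col x y + S        ≤⟨ +-monoˡ-≤ S (col≤st+d x y (≢₂ ne)) ⟩
    st x + d + S       ≡⟨ sym (second-top x) ⟩
    st x + D + (D + D) ∎

  -- Colours at a vertex of one copy never coincide with colours at it coming
  -- from the other copy: they lie in disjoint parts of its window.
  own<cross : ∀ x y y′ → x ≢ y → col x y < cross x y′
  own<cross x y y′ x≢y = ≤-trans (col<st+D x y x≢y) (cross≥ x y′)

  cross<shifted : ∀ x y y′ → x ≢ y′ → cross x y < col x y′ + S
  cross<shifted x y y′ x≢y′ = begin-strict
    cross x y          ≤⟨ cross≤ x y ⟩
    st x + (D + D)     <⟨ +-monoʳ-< (st x) (+-monoʳ-< D ≤-refl) ⟩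
    st x + S           ≤⟨ +-monoˡ-≤ S (col≥st x y′ x≢y′) ⟩
    col x y′ + S       ∎

  proper² : ∀ v u w → v ≢ u → v ≢ w → col² v u ≡ col² v w → u ≡ w
  proper² (inj₁ x) (inj₁ y) (inj₁ y′) nu nw e = cong inj₁ (proper x y y′ (≢₁ nu) (≢₁ nw) e)
  proper² (inj₁ x) (inj₁ y) (inj₂ y′) nu _  e = ⊥-elim (<⇒≢ (own<cross x y y′ (≢₁ nu)) e)
  proper² (inj₁ x) (inj₂ y) (inj₁ y′) _  nw e = ⊥-elim (<⇒≢ (own<cross x y′ y (≢₁ nw)) (sym e))
  proper² (inj₁ x) (inj₂ y) (inj₂ y′) _  _  e = cong inj₂ (cross-injective x y y′ e)
  proper² (inj₂ x) (inj₁ y) (inj₁ y′) _  _  e =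
    cong inj₁ (cross-injective x y y′ (trans (cross-sym x y) (trans e (cross-sym y′ x))))
  proper² (inj₂ x) (inj₁ y) (inj₂ y′) _  nw e = ⊥-elim (<⇒≢ (cross<shifted x y y′ (≢₂ nw)) (trans (cross-sym x y) e))
  proper² (inj₂ x) (inj₂ y) (inj₁ y′) nu _  e = ⊥-elim (<⇒≢ (cross<shifted x y′ y (≢₂ nu)) (trans (cross-sym x y′) (sym e)))
  proper² (inj₂ x) (inj₂ y) (inj₂ y′) nu nw e = cong inj₂ (proper x y y′ (≢₂ nu) (≢₂ nw) (+-cancelʳ-≡ S _ _ e))

  onto² : ∀ v z → st² v ≤ z → z ≤ st² v + (D + D) → Σ (V ⊎ V) λ u → (v ≢ u) × (col² v u ≡ z)
  onto² (inj₁ x) z l h with z ≤? st x + d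
  ... | yes z≤ with onto x z l z≤
  ...   | y , x≢y , e = inj₁ y , (λ q → x≢y (cong underlying q)) , e
  onto² (inj₁ x) z l h | no z≰ with cross-onto x z (≡-≤ (+-suc (st x) d) (≰⇒> z≰))
                                     (≤-≡ h (sym (+-assoc (st x) D D)))
  ... | y , e = inj₂ y , (λ ()) , e
  onto² (inj₂ x) z l h with z ≤? st x + D + D
  ... | yes z≤ with cross-onto x z l z≤
  ...   | y , e = inj₁ y , (λ ()) , trans (cross-sym y x) e
  onto² (inj₂ x) z l h | no z≰ with m≤n⇒∃[o]m+o≡n (≰⇒> z≰)
  ... | e , refl with onto x (st x + e) (m≤m+n (st x) e) (+-monoʳ-≤ (st x) e≤d)
    where
    e≤d : e ≤ d
    e≤d = +-cancelˡ-≤ (suc (st x + D + D)) e d (begin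
      suc (st x + D + D) + e ≤⟨ h ⟩
      st x + D + (D + D)     ≡⟨ identity (st x) d ⟩
      suc (st x + D + D) + d ∎)
      where
      identity : ∀ a d → a + suc d + (suc d + suc d) ≡ suc (a + suc d + suc d) + d
      identity = solve-∀
  ...   | y , x≢y , col≡ = inj₂ y , (λ q → x≢y (cong underlying q)) , (begin-equality
    col x y + S              ≡⟨ cong (_+ S) col≡ ⟩
    st x + e + S             ≡⟨ identity (st x) e d ⟩
    suc (st x + D + D) + e   ∎)
    where
    identity : ∀ a e d → a + e + (suc d + suc (suc d)) ≡ suc (a + suc d + suc d) + e
    identity = solve-∀

  doubled : WindowColouring (V ⊎ V) (D + D) (t + S)
  doubled = record
    { col = col² ; st = st² ; col-sym = col²-sym ; proper = proper²
    ; col≥st = col²≥st² ; col≤st+d = col²≤st²+2D ; onto = onto²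
    ; st≥1 = λ { (inj₁ x) → st≥1 x ; (inj₂ x) → ≤-trans (st≥1 x) (m≤m+n (st x) D) }
    ; st+d≤t = fits
    ; bottom = inj₁ (proj₁ bottom) , proj₂ bottom
    ; top = inj₂ (proj₁ top) , trans (second-top (proj₁ top)) (cong (_+ S) (proj₂ top))
    }
    where
    fits : ∀ v → st² v + (D + D) ≤ t + S
    fits (inj₁ x) = begin
      st x + (D + D)   ≡⟨ identity (st x) d ⟩
      st x + d + suc D ≤⟨ +-mono-≤ (st+d≤t x) (m≤n+m (suc D) D) ⟩
      t + S            ∎
      where
      identity : ∀ a d → a + (suc d + suc d) ≡ a + d + suc (suc d)
      identity = solve-∀
    fits (inj₂ x) = ≡-≤ (second-top x) (+-monoˡ-≤ S (st+d≤t x))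

parity : ∀ z → Σ ℕ λ h → (z ≡ 2 * h) ⊎ (z ≡ suc (2 * h))
parity zero = 0 , inj₁ refl
parity (suc z) with parity z
... | h , inj₁ z≡2h  = h , inj₂ (cong suc z≡2h)
... | h , inj₂ z≡2h+1 = suc h , inj₁ (trans (cong suc z≡2h+1) (sym (cong suc (+-suc h (h + 0)))))

toFin : ∀ {n} e → e < n → Σ (Fin n) λ f → toℕ f ≡ e
toFin e e<n = fromℕ< e<n , toℕ-fromℕ< e<n

-- For p = m + 2 we colour K_{2p} on the vertices
-- a₀, …, a_{m+2}, b₀, …, b_{m-1}, ∞ by
--   a_i a_j ↦ i + j,   a_i b_k ↦ i + k + m + 3,   b_k b_l ↦ k + l + 3,
--   ∞ a₀ ↦ 2m + 3,     ∞ a_i ↦ 2i (i ≥ 1),       ∞ b_k ↦ 2k + 3.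
-- At a_i (i ≥ 1) and b_k the vertex ∞ takes the colour the first three
-- formulas would give to the missing loop a_i a_i, resp. b_k b_k.  The
-- windows start at 1 (a₀), i (a_i), k + 3 (b_k) and 2 (∞), have width
-- 2m + 2 = 2p − 2, and the span is 3m + 4 = 3p − 2.
module BaseColouring (m : ℕ) where
  open ≤-Reasoning

  data Vertex : Set where
    a : Fin (3 + m) → Vertex
    b : Fin m → Vertex
    ∞ : Vertex

  d t : ℕ
  d = suc (suc (m + m))
  t = suc (suc (suc (suc (m + m + m))))

  a≤ : (i : Fin (3 + m)) → toℕ i ≤ 2 + m
  a≤ i = s≤s⁻¹ (toℕ<n i)

  b< : (k : Fin m) → suc (toℕ k) ≤ m
  b< k = toℕ<n k

  col∞ : Vertex → ℕ
  col∞ (a zero)    = suc (2 * suc m)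
  col∞ (a (suc i)) = 2 * suc (toℕ i)
  col∞ (b k)       = suc (2 * suc (toℕ k))
  col∞ ∞           = 0

  col : Vertex → Vertex → ℕ
  col ∞     v     = col∞ v
  col v     ∞     = col∞ v
  col (a i) (a j) = toℕ i + toℕ j
  col (a i) (b k) = toℕ i + toℕ k + (3 + m)
  col (b k) (a i) = toℕ i + toℕ k + (3 + m)
  col (b k) (b l) = toℕ k + toℕ l + 3

  st : Vertex → ℕ
  st (a zero)    = 1
  st (a (suc i)) = suc (toℕ i)
  st (b k)       = toℕ k + 3
  st ∞           = 2

  col-sym : ∀ u v → u ≢ v → col u v ≡ col v u
  col-sym (a i) (a j) _ = +-comm (toℕ i) (toℕ j)
  col-sym (a i) (b k) _ = refl
  col-sym (a i) ∞     _ = refl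
  col-sym (b k) (a i) _ = refl
  col-sym (b k) (b l) _ = cong (_+ 3) (+-comm (toℕ k) (toℕ l))
  col-sym (b k) ∞     _ = refl
  col-sym ∞     (a i) _ = refl
  col-sym ∞     (b k) _ = refl
  col-sym ∞     ∞     _ = refl

  a-loop : ∀ (i : Fin (2 + m)) → 2 * suc (toℕ i) ≡ col (a (suc i)) (a (suc i))
  a-loop i = cong (suc (toℕ i) +_) (+-identityʳ (suc (toℕ i)))

  b-loop : ∀ (k : Fin m) → suc (2 * suc (toℕ k)) ≡ col (b k) (b k)
  b-loop k = identity (toℕ k)
    where
    identity : ∀ k → suc (2 * suc k) ≡ k + k + 3
    identity = solve-∀

  -- The colours at every vertex lie in its window [st v, st v + d]; for
  -- a_{i+1} and b_k this holds even for the loop formula used by ∞.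
  a-window : ∀ (i : Fin (2 + m)) j → (st (a (suc i)) ≤ col (a (suc i)) (a j)) × (col (a (suc i)) (a j) ≤ st (a (suc i)) + d)
  a-window i j = m≤m+n _ _ , +-monoʳ-≤ (suc (toℕ i)) (≤-trans (a≤ j) (s≤s (s≤s (m≤m+n m m))))

  b-window : ∀ k (l : Fin m) → (st (b k) ≤ col (b k) (b l)) × (col (b k) (b l) ≤ st (b k) + d)
  b-window k l = +-monoˡ-≤ 3 (m≤m+n (toℕ k) (toℕ l)) , (begin
    toℕ k + toℕ l + 3 ≡⟨ +-assoc (toℕ k) (toℕ l) 3 ⟩
    toℕ k + (toℕ l + 3) ≡⟨ cong (toℕ k +_) (+-comm (toℕ l) 3) ⟩
    toℕ k + (3 + toℕ l) ≡⟨ sym (+-assoc (toℕ k) 3 (toℕ l)) ⟩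
    toℕ k + 3 + toℕ l ≤⟨ +-monoʳ-≤ (toℕ k + 3) (≤-trans (<⇒≤ (b< l)) (≤-trans (m≤m+n m m) (≤-trans (n≤1+n _) (n≤1+n _)))) ⟩
    toℕ k + 3 + d ∎)

  ∞-at-a₀ : col∞ (a zero) ≡ st (a zero) + d
  ∞-at-a₀ = identity m
    where
    identity : ∀ m → suc (2 * suc m) ≡ 1 + suc (suc (m + m))
    identity = solve-∀

  a₀a<∞ : ∀ j → col (a zero) (a j) < col∞ (a zero)
  a₀a<∞ j = begin-strict
    toℕ j           ≤⟨ a≤ j ⟩
    2 + m           <⟨ s≤s (s≤s (s≤s (m≤n+m m m))) ⟩
    3 + (m + m)     ≡⟨ identity m ⟩
    suc (2 * suc m) ∎
    where
    identity : ∀ m → 3 + (m + m) ≡ suc (2 * suc m)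
    identity = solve-∀

  a₀b<∞ : ∀ k → col (a zero) (b k) < col∞ (a zero)
  a₀b<∞ k = begin-strict
    toℕ k + (3 + m) <⟨ +-monoˡ-< (3 + m) (b< k) ⟩
    m + (3 + m)     ≡⟨ identity m ⟩
    suc (2 * suc m) ∎
    where
    identity : ∀ m → m + (3 + m) ≡ suc (2 * suc m)
    identity = solve-∀

  in-window : ∀ v u → v ≢ u → (st v ≤ col v u) × (col v u ≤ st v + d)
  in-window (a zero) (a zero) ne = ⊥-elim (ne refl)
  in-window (a zero) (a (suc j)) _ = s≤s z≤n , ≤-≡ (<⇒≤ (a₀a<∞ (suc j))) ∞-at-a₀
  in-window (a zero) (b k) _ = ≤-trans (s≤s z≤n) (m≤n+m (3 + m) (toℕ k)) , ≤-≡ (<⇒≤ (a₀b<∞ k)) ∞-at-a₀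
  in-window (a zero) ∞ _ = s≤s z≤n , ≤-reflexive ∞-at-a₀
  in-window (a (suc i)) (a j) _ = a-window i j
  in-window (a (suc i)) (b k) _ = ≤-trans (m≤m+n _ (toℕ k)) (m≤m+n _ _) , (begin
    suc (toℕ i) + toℕ k + (3 + m)   ≡⟨ +-assoc (suc (toℕ i)) (toℕ k) (3 + m) ⟩
    suc (toℕ i) + (toℕ k + (3 + m)) ≤⟨ +-monoʳ-≤ (suc (toℕ i)) (k+3+m≤d (toℕ k) (b< k)) ⟩
    suc (toℕ i) + d                 ∎)
    where
    k+3+m≤d : ∀ k → suc k ≤ m → k + (3 + m) ≤ d
    k+3+m≤d k k<m = begin
      k + (3 + m)     ≡⟨ +-suc k (2 + m) ⟩
      suc k + (2 + m) ≤⟨ +-monoˡ-≤ (2 + m) k<m ⟩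
      m + (2 + m)     ≡⟨ identity m ⟩
      d               ∎
      where
      identity : ∀ m → m + (2 + m) ≡ suc (suc (m + m))
      identity = solve-∀
  in-window (a (suc i)) ∞ _ rewrite a-loop i = a-window i (suc i)
  in-window (b k) (a i) _ = lower , upper
    where
    lower : toℕ k + 3 ≤ toℕ i + toℕ k + (3 + m)
    lower = +≡⇒≤ (toℕ k + 3) (toℕ i + m) (identity (toℕ i) (toℕ k) m)
      where
      identity : ∀ i k m → k + 3 + (i + m) ≡ i + k + (3 + m)
      identity = solve-∀
    upper : toℕ i + toℕ k + (3 + m) ≤ toℕ k + 3 + d
    upper = begin
      toℕ i + toℕ k + (3 + m) ≤⟨ +-monoˡ-≤ (3 + m) (+-monoˡ-≤ (toℕ k) (a≤ i)) ⟩
      2 + m + toℕ k + (3 + m) ≡⟨ identity (toℕ k) m ⟩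
      toℕ k + 3 + d           ∎
      where
      identity : ∀ k m → 2 + m + k + (3 + m) ≡ k + 3 + suc (suc (m + m))
      identity = solve-∀
  in-window (b k) (b l) _ = b-window k l
  in-window (b k) ∞ _ rewrite b-loop k = b-window k k
  in-window ∞ (a zero) _ = s≤s (s≤s z≤n) , ≤-≡ (n≤1+n _) (identity m)
    where
    identity : ∀ m → suc (suc (2 * suc m)) ≡ 2 + suc (suc (m + m))
    identity = solve-∀
  in-window ∞ (a (suc i)) _ = *-monoʳ-≤ 2 (s≤s z≤n) , (begin
    2 * suc (toℕ i) ≤⟨ *-monoʳ-≤ 2 (a≤ (suc i)) ⟩
    2 * (2 + m)     ≡⟨ identity m ⟩
    2 + d           ∎)
    where
    identity : ∀ m → 2 * (2 + m) ≡ 2 + suc (suc (m + m))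
    identity = solve-∀
  in-window ∞ (b k) _ = s≤s (≤-trans (s≤s z≤n) (*-monoʳ-≤ 2 (s≤s z≤n))) , (begin
    suc (2 * suc (toℕ k)) ≤⟨ s≤s (*-monoʳ-≤ 2 (b< k)) ⟩
    suc (2 * m)           ≡⟨ cong suc (identity m) ⟩
    suc (m + m)           ≤⟨ ≤-trans (n≤1+n _) (≤-trans (n≤1+n _) (n≤1+n _)) ⟩
    2 + d                 ∎)
    where
    identity : ∀ m → 2 * m ≡ m + m
    identity = solve-∀
  in-window ∞ ∞ ne = ⊥-elim (ne refl)

  aa-cancel : ∀ i {j j′} → col (a i) (a j) ≡ col (a i) (a j′) → j ≡ j′
  aa-cancel i e = toℕ-injective (+-cancelˡ-≡ (toℕ i) _ _ e)

  ab-cancel : ∀ i {k k′} → col (a i) (b k) ≡ col (a i) (b k′) → k ≡ k′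
  ab-cancel i e = toℕ-injective (+-cancelˡ-≡ (toℕ i) _ _ (+-cancelʳ-≡ (3 + m) _ _ e))

  ba-cancel : ∀ k {i i′} → col (b k) (a i) ≡ col (b k) (a i′) → i ≡ i′
  ba-cancel k e = toℕ-injective (+-cancelʳ-≡ (toℕ k) _ _ (+-cancelʳ-≡ (3 + m) _ _ e))

  bb-cancel : ∀ k {l l′} → col (b k) (b l) ≡ col (b k) (b l′) → l ≡ l′
  bb-cancel k e = toℕ-injective (+-cancelˡ-≡ (toℕ k) _ _ (+-cancelʳ-≡ 3 _ _ e))

  aa<ab : ∀ i j k → col (a i) (a j) < col (a i) (b k)
  aa<ab i j k = begin-strict
    toℕ i + toℕ j           <⟨ +-monoʳ-< (toℕ i) (≤-trans (s≤s (a≤ j)) (m≤n+m (3 + m) (toℕ k))) ⟩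
    toℕ i + (toℕ k + (3 + m)) ≡⟨ sym (+-assoc (toℕ i) (toℕ k) (3 + m)) ⟩
    toℕ i + toℕ k + (3 + m) ∎

  bb<ba : ∀ k l i → col (b k) (b l) < col (b k) (a i)
  bb<ba k l i = begin-strict
    toℕ k + toℕ l + 3       <⟨ +-monoˡ-< 3 (+-monoʳ-< (toℕ k) (b< l)) ⟩
    toℕ k + m + 3           ≤⟨ m≤n+m _ (toℕ i) ⟩
    toℕ i + (toℕ k + m + 3) ≡⟨ identity (toℕ i) (toℕ k) m ⟩
    toℕ i + toℕ k + (3 + m) ∎
    where
    identity : ∀ i k m → i + (k + m + 3) ≡ i + k + (3 + m)
    identity = solve-∀

  proper : ∀ v u w → v ≢ u → v ≢ w → col v u ≡ col v w → u ≡ w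
  proper (a i) (a j) (a j′) _ _ e = cong a (aa-cancel i e)
  proper (a i) (a j) (b k) _ _ e = ⊥-elim (<⇒≢ (aa<ab i j k) e)
  proper (a i) (b k) (a j) _ _ e = ⊥-elim (<⇒≢ (aa<ab i j k) (sym e))
  proper (a i) (b k) (b k′) _ _ e = cong b (ab-cancel i e)
  proper (a i) ∞ ∞ _ _ _ = refl
  proper (a zero) (a j) ∞ _ _ e = ⊥-elim (<⇒≢ (a₀a<∞ j) e)
  proper (a zero) ∞ (a j) _ _ e = ⊥-elim (<⇒≢ (a₀a<∞ j) (sym e))
  proper (a zero) (b k) ∞ _ _ e = ⊥-elim (<⇒≢ (a₀b<∞ k) e)
  proper (a zero) ∞ (b k) _ _ e = ⊥-elim (<⇒≢ (a₀b<∞ k) (sym e))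
  proper (a (suc i)) (a j) ∞ nu _ e = ⊥-elim (nu (cong a (sym (aa-cancel (suc i) (trans e (a-loop i))))))
  proper (a (suc i)) ∞ (a j) _ nw e = ⊥-elim (nw (cong a (sym (aa-cancel (suc i) (trans (sym e) (a-loop i))))))
  proper (a (suc i)) (b k) ∞ _ _ e = ⊥-elim (<⇒≢ (aa<ab (suc i) (suc i) k) (sym (trans e (a-loop i))))
  proper (a (suc i)) ∞ (b k) _ _ e = ⊥-elim (<⇒≢ (aa<ab (suc i) (suc i) k) (trans (sym (a-loop i)) e))
  proper (b k) (a i) (a i′) _ _ e = cong a (ba-cancel k e)
  proper (b k) (a i) (b l) _ _ e = ⊥-elim (<⇒≢ (bb<ba k l i) (sym e))
  proper (b k) (b l) (a i) _ _ e = ⊥-elim (<⇒≢ (bb<ba k l i) e)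
  proper (b k) (b l) (b l′) _ _ e = cong b (bb-cancel k e)
  proper (b k) (a i) ∞ _ _ e = ⊥-elim (<⇒≢ (bb<ba k k i) (sym (trans e (b-loop k))))
  proper (b k) ∞ (a i) _ _ e = ⊥-elim (<⇒≢ (bb<ba k k i) (trans (sym (b-loop k)) e))
  proper (b k) (b l) ∞ nu _ e = ⊥-elim (nu (cong b (sym (bb-cancel k (trans e (b-loop k))))))
  proper (b k) ∞ (b l) _ nw e = ⊥-elim (nw (cong b (sym (bb-cancel k (trans (sym e) (b-loop k))))))
  proper (b k) ∞ ∞ _ _ _ = refl
  proper ∞ ∞ _ nu _ _ = ⊥-elim (nu refl)
  proper ∞ _ ∞ _ nw _ = ⊥-elim (nw refl)
  proper ∞ (a zero) (a zero) _ _ _ = refl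
  proper ∞ (a zero) (a (suc j)) _ _ e = ⊥-elim (even≢odd (suc (toℕ j)) (suc m) (sym e))
  proper ∞ (a (suc i)) (a zero) _ _ e = ⊥-elim (even≢odd (suc (toℕ i)) (suc m) e)
  proper ∞ (a (suc i)) (a (suc j)) _ _ e = cong (λ x → a (suc x)) (toℕ-injective (suc-injective (*-cancelˡ-≡ _ _ 2 e)))
  proper ∞ (a zero) (b k) _ _ e = ⊥-elim (<⇒≢ (b< k) (sym (suc-injective (*-cancelˡ-≡ _ _ 2 (suc-injective e)))))
  proper ∞ (b k) (a zero) _ _ e = ⊥-elim (<⇒≢ (b< k) (suc-injective (*-cancelˡ-≡ _ _ 2 (suc-injective e))))
  proper ∞ (a (suc i)) (b k) _ _ e = ⊥-elim (even≢odd (suc (toℕ i)) (suc (toℕ k)) e)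
  proper ∞ (b k) (a (suc i)) _ _ e = ⊥-elim (even≢odd (suc (toℕ i)) (suc (toℕ k)) (sym e))
  proper ∞ (b k) (b l) _ _ e = cong b (toℕ-injective (suc-injective (*-cancelˡ-≡ _ _ 2 (suc-injective e))))

  Used : Vertex → ℕ → Set
  Used v z = Σ Vertex λ u → (v ≢ u) × (col v u ≡ z)

  -- At a₀ the colours 1, …, m + 2 go to a₁, …, a_{m+2}, the colours
  -- m + 3, …, 2m + 2 to b₀, …, b_{m-1} and 2m + 3 to ∞.
  onto-a₀ : ∀ z → 1 ≤ z → z ≤ st (a zero) + d → Used (a zero) z
  onto-a₀ (suc z) _ h with suc z ≤? 2 + m
  ... | yes z<2+m with toFin z z<2+m
  ...   | f , refl = a (suc f) , (λ ()) , refl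
  onto-a₀ (suc z) _ h | no z≮2+m with m≤n⇒∃[o]m+o≡n (≰⇒> z≮2+m)
  ... | e , z≡ with e <? m
  ...   | yes e<m with toFin e e<m
  ...     | f , refl = b f , (λ ()) , trans (+-comm (toℕ f) (3 + m)) z≡
  onto-a₀ (suc z) _ h | no _ | e , z≡ | no e≮m = ∞ , (λ ()) , (begin-equality
    suc (2 * suc m) ≡⟨ identity m ⟩
    3 + m + m       ≡⟨ cong (3 + m +_) (≤-antisym e≤m (≮⇒≥ e≮m)) ⟨
    3 + m + e       ≡⟨ z≡ ⟩
    suc z           ∎)
    where
    identity : ∀ m → suc (2 * suc m) ≡ 3 + m + m
    identity = solve-∀
    e≤m : e ≤ m
    e≤m = +-cancelˡ-≤ (3 + m) e m (≡-≤ z≡ (≤-≡ h (cong (3 +_) (+-comm m m))))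

  -- At a_i (i ≥ 1) the colour i + e goes to a_e for e ≤ m + 2 (to ∞ when
  -- e = i), and to b_{e−m−3} above.
  onto-aₛ : ∀ i z → st (a (suc i)) ≤ z → z ≤ st (a (suc i)) + d → Used (a (suc i)) z
  onto-aₛ i z l h with m≤n⇒∃[o]m+o≡n l
  ... | e , refl with e ≤? 2 + m
  ...   | yes e≤2+m with e ≟ suc (toℕ i) | toFin e (s≤s e≤2+m)
  ...     | yes refl | _ = ∞ , (λ ()) , a-loop i
  ...     | no e≢ | f , refl = a f , (λ q → e≢ (sym (cong toℕ (a-injective q)))) , refl
    where
    a-injective : ∀ {j j′} → a j ≡ a j′ → j ≡ j′
    a-injective refl = refl
  onto-aₛ i z l h | e , refl | no e≰2+m with m≤n⇒∃[o]m+o≡n (≰⇒> e≰2+m)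
  ... | g , refl with toFin g g<m
    where
    g<m : g < m
    g<m = +-cancelˡ-≤ (3 + m) (suc g) m (begin
      3 + m + suc g     ≡⟨ +-suc (3 + m) g ⟩
      suc (3 + m + g)   ≤⟨ s≤s (+-cancelˡ-≤ (suc (toℕ i)) _ _ h) ⟩
      suc d             ≡⟨ cong (3 +_) (+-comm m m) ⟩
      3 + m + m         ∎)
  ...   | f , refl = b f , (λ ()) , trans (+-assoc (suc (toℕ i)) (toℕ f) (3 + m))
                                        (cong (suc (toℕ i) +_) (+-comm (toℕ f) (3 + m)))

  -- At b_k the colour k + 3 + e goes to b_e for e < m (to ∞ when e = k),
  -- and to a_{e−m} above.
  onto-b : ∀ k z → st (b k) ≤ z → z ≤ st (b k) + d → Used (b k) z
  onto-b k z l h with m≤n⇒∃[o]m+o≡n l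
  ... | e , refl with e <? m
  ...   | yes e<m with e ≟ toℕ k | toFin e e<m
  ...     | yes refl | _ = ∞ , (λ ()) , identity (toℕ k)
    where
    identity : ∀ k → suc (2 * suc k) ≡ k + 3 + k
    identity = solve-∀
  ...     | no e≢ | f , refl = b f , (λ q → e≢ (sym (cong toℕ (b-injective q)))) , identity (toℕ k) (toℕ f)
    where
    b-injective : ∀ {l l′} → b l ≡ b l′ → l ≡ l′
    b-injective refl = refl
    identity : ∀ k l → k + l + 3 ≡ k + 3 + l
    identity = solve-∀
  onto-b k z l h | e , refl | no e≮m with m≤n⇒∃[o]m+o≡n (≮⇒≥ e≮m)
  ... | g , refl with toFin g g<3+m
    where
    g<3+m : g < 3 + m
    g<3+m = s≤s (+-cancelˡ-≤ m g (2 + m) (begin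
      m + g         ≤⟨ +-cancelˡ-≤ (toℕ k + 3) _ _ h ⟩
      d             ≡⟨ identity m ⟩
      m + (2 + m)   ∎))
      where
      identity : ∀ m → suc (suc (m + m)) ≡ m + (2 + m)
      identity = solve-∀
  ...   | f , refl = a f , (λ ()) , identity (toℕ f) (toℕ k) m
    where
    identity : ∀ i k m → i + k + (3 + m) ≡ k + 3 + (m + i)
    identity = solve-∀

  -- At ∞ the even colours 2, …, 2m + 4 go to a₁, …, a_{m+2} and the odd
  -- colours 3, …, 2m + 1, 2m + 3 to b₀, …, b_{m-1}, a₀.
  onto-∞ : ∀ z → st ∞ ≤ z → z ≤ st ∞ + d → Used ∞ z
  onto-∞ z l h with parity z
  ... | zero , inj₁ refl = ⊥-elim (<⇒≱ l z≤n)
  ... | zero , inj₂ refl = ⊥-elim (<⇒≱ l (s≤s z≤n))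
  ... | suc h′ , inj₁ refl with toFin h′ h′<2+m
    where
    h′<2+m : h′ < 2 + m
    h′<2+m = *-cancelˡ-≤ 2 (≤-≡ h (identity m))
      where
      identity : ∀ m → 2 + suc (suc (m + m)) ≡ 2 * (2 + m)
      identity = solve-∀
  ...   | f , refl = a (suc f) , (λ ()) , refl
  onto-∞ z l h | suc g , inj₂ refl with g <? m
  ... | yes g<m with toFin g g<m
  ...   | f , refl = b f , (λ ()) , refl
  onto-∞ z l h | suc g , inj₂ refl | no g≮m = a zero , (λ ()) , cong (λ x → suc (2 * suc x)) (≤-antisym (≮⇒≥ g≮m) g≤m)
    where
    g≤m : g ≤ m
    g≤m = s≤s⁻¹ (s≤s⁻¹ (*-cancelˡ-< 2 (suc g) (2 + m) (≤-≡ h (identity m))))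
      where
      identity : ∀ m → 2 + suc (suc (m + m)) ≡ 2 * (2 + m)
      identity = solve-∀

  onto : ∀ v z → st v ≤ z → z ≤ st v + d → Used v z
  onto (a zero)    = onto-a₀
  onto (a (suc i)) = onto-aₛ i
  onto (b k)       = onto-b k
  onto ∞           = onto-∞

  st+d≤t : ∀ v → st v + d ≤ t
  st+d≤t (a zero) = +≡⇒≤ _ (suc m) (identity m)
    where
    identity : ∀ m → 1 + suc (suc (m + m)) + suc m ≡ suc (suc (suc (suc (m + m + m))))
    identity = solve-∀
  st+d≤t (a (suc i)) = ≤-≡ (+-monoˡ-≤ d (a≤ (suc i))) (identity m)
    where
    identity : ∀ m → 2 + m + suc (suc (m + m)) ≡ suc (suc (suc (suc (m + m + m))))
    identity = solve-∀
  st+d≤t (b k) = begin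
    toℕ k + 3 + d           ≡⟨ shift (toℕ k) m ⟩
    suc (toℕ k) + (2 + d)   ≤⟨ +-monoˡ-≤ (2 + d) (b< k) ⟩
    m + (2 + d)             ≡⟨ identity m ⟩
    t                       ∎
    where
    shift : ∀ k m → k + 3 + suc (suc (m + m)) ≡ suc k + (2 + suc (suc (m + m)))
    shift = solve-∀
    identity : ∀ m → m + (2 + suc (suc (m + m))) ≡ suc (suc (suc (suc (m + m + m))))
    identity = solve-∀
  st+d≤t ∞ = +≡⇒≤ _ m (identity m)
    where
    identity : ∀ m → 2 + suc (suc (m + m)) + m ≡ suc (suc (suc (suc (m + m + m))))
    identity = solve-∀

  a-top : st (a (suc (fromℕ (suc m)))) + d ≡ t
  a-top = trans (cong (λ x → suc x + d) (toℕ-fromℕ (suc m))) (identity m)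
    where
    identity : ∀ m → suc (suc m) + suc (suc (m + m)) ≡ suc (suc (suc (suc (m + m + m))))
    identity = solve-∀

  colouring : WindowColouring Vertex d t
  colouring = record
    { col = col ; st = st ; col-sym = col-sym ; proper = proper
    ; col≥st = λ v u ne → proj₁ (in-window v u ne)
    ; col≤st+d = λ v u ne → proj₂ (in-window v u ne)
    ; onto = onto
    ; st≥1 = λ { (a zero) → ≤-refl ; (a (suc i)) → s≤s z≤n ; (b k) → ≤-trans (s≤s z≤n) (m≤n+m 3 (toℕ k)) ; ∞ → s≤s z≤n }
    ; st+d≤t = st+d≤t
    ; bottom = a zero , refl
    ; top = a (suc (fromℕ (suc m))) , a-top
    }

  Fin↔Vertex : Fin (3 + m + (m + 1)) ↔ Vertex
  Fin↔Vertex = ↔-trans +↔⊎ (↔-trans (↔-refl ⊎-↔ +↔⊎) (mk↔ₛ′ to from to-from from-to))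
    where
    to : Fin (3 + m) ⊎ (Fin m ⊎ Fin 1) → Vertex
    to (inj₁ i)        = a i
    to (inj₂ (inj₁ k)) = b k
    to (inj₂ (inj₂ _)) = ∞
    from : Vertex → Fin (3 + m) ⊎ (Fin m ⊎ Fin 1)
    from (a i) = inj₁ i
    from (b k) = inj₂ (inj₁ k)
    from ∞     = inj₂ (inj₂ zero)
    to-from : ∀ v → to (from v) ≡ v
    to-from (a i) = refl
    to-from (b k) = refl
    to-from ∞     = refl
    from-to : ∀ x → from (to x) ≡ x
    from-to (inj₁ i)           = refl
    from-to (inj₂ (inj₁ k))    = refl
    from-to (inj₂ (inj₂ zero)) = refl

-- Write n = p · 2^q.  K_{2n} has a window colouring of width
-- 2n − 2 whose span t satisfies 4n ≤ t + p + q + 2, i.e. t ≥ 4n − 2 − p − q: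
-- for q = 0 this is the base colouring (t = 3p − 2), and doubling n adds
-- 2(2n − 1) + 1 = 4n − 1 to t, keeping the inequality with q + 1.
record Large (n p q : ℕ) : Set where
  field
    {d t}     : ℕ
    colouring : WindowColouring (Fin (n + n)) d t
    width     : suc (suc d) ≡ n + n
    span      : 4 * n ≤ t + p + q + 2

base : ∀ p → 1 ≤ p → Large p p 0
base (suc zero) _ = record { colouring = K₂-colouring ; width = refl ; span = ≤-refl }
base (suc (suc m)) _ = record
  { colouring = subst (λ N → WindowColouring (Fin N) d t) (identity m)
                      (transport Fin↔Vertex colouring)
  ; width = width m
  ; span = ≤-reflexive (span m)
  }
  where
  open BaseColouring m using (Fin↔Vertex; colouring; d; t)
  identity : ∀ m → 3 + m + (m + 1) ≡ suc (suc m) + suc (suc m)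
  identity = solve-∀
  width : ∀ m → suc (suc (suc (suc (m + m)))) ≡ suc (suc m) + suc (suc m)
  width = solve-∀
  span : ∀ m → 4 * suc (suc m) ≡ suc (suc (suc (suc (m + m + m)))) + suc (suc m) + 0 + 2
  span = solve-∀

double : ∀ {n p q} → Large n p q → Large (n + n) p (suc q)
double {n} {p} {q} L = record
  { colouring = transport +↔⊎ (Doubling.doubled _≟ᶠ_ colouring)
  ; width = trans (identity d) (cong₂ _+_ width width)
  ; span = begin
      4 * (n + n)                          ≡⟨ regroup n ⟩
      4 * n + (n + n) + (n + n)            ≤⟨ +-monoˡ-≤ (n + n) (+-monoˡ-≤ (n + n) span) ⟩
      t + p + q + 2 + (n + n) + (n + n)    ≡⟨ cong (λ x → t + p + q + 2 + x + x) width ⟨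
      t + p + q + 2 + suc (suc d) + suc (suc d) ≡⟨ regroup′ t d p q ⟩
      t + (suc d + suc (suc d)) + p + suc q + 2 ∎
  }
  where
  open Large L
  open ≤-Reasoning
  identity : ∀ d → suc (suc (suc d + suc d)) ≡ suc (suc d) + suc (suc d)
  identity = solve-∀
  regroup : ∀ n → 4 * (n + n) ≡ 4 * n + (n + n) + (n + n)
  regroup = solve-∀
  regroup′ : ∀ t d p q → t + p + q + 2 + suc (suc d) + suc (suc d) ≡ t + (suc d + suc (suc d)) + p + suc q + 2
  regroup′ = solve-∀

large : ∀ p q → 1 ≤ p → Large (p * 2 ^ q) p q
large p zero    1≤p = subst (λ n → Large n p 0) (sym (*-identityʳ p)) (base p 1≤p)
large p (suc q) 1≤p = subst (λ n → Large n p (suc q)) (identity p (2 ^ q)) (double (large p q 1≤p))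
  where
  identity : ∀ p x → p * x + p * x ≡ p * (2 * x)
  identity = solve-∀

-- The four ways in which a window [K, K + d] and two further colours X, Y
-- can tile the window [lo, lo + d + 2] (listed from the bottom up).  In the
-- product colouring, K is the start of the complete-graph colours at a
-- vertex and X, Y are the colours of its two cycle edges.
data Layout (d lo K X Y : ℕ) : Set where
  K-X-Y : K ≡ lo → X ≡ lo + suc d → Y ≡ lo + suc (suc d) → Layout d lo K X Y
  Y-K-X : Y ≡ lo → K ≡ suc lo → X ≡ lo + suc (suc d) → Layout d lo K X Y
  X-K-Y : X ≡ lo → K ≡ suc lo → Y ≡ lo + suc (suc d) → Layout d lo K X Y
  Y-X-K : Y ≡ lo → X ≡ suc lo → K ≡ suc (suc lo) → Layout d lo K X Y

module _ {d lo K X Y : ℕ} where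
  private
    lo+d+1<lo+d+2 : lo + suc d < lo + suc (suc d)
    lo+d+1<lo+d+2 = +-monoʳ-< lo ≤-refl

    lo<lo+d+2 : lo < lo + suc (suc d)
    lo<lo+d+2 = ≤-≡ (s≤s (m≤m+n lo (suc d))) (sym (+-suc lo (suc d)))

    1+lo+d≤lo+d+2 : suc lo + d ≤ lo + suc (suc d)
    1+lo+d≤lo+d+2 = +≡⇒≤ (suc lo + d) 1 (identity lo d)
      where
      identity : ∀ lo d → suc lo + d + 1 ≡ lo + suc (suc d)
      identity = solve-∀

    2+lo+d≡lo+d+2 : suc (suc lo) + d ≡ lo + suc (suc d)
    2+lo+d≡lo+d+2 = identity lo d
      where
      identity : ∀ lo d → suc (suc lo) + d ≡ lo + suc (suc d)
      identity = solve-∀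

  layout-split : Layout d lo K X Y → ∀ z → z ∈[ lo ,+ suc (suc d) ] → z ∈[ K ,+ d ] ⊎ (z ≡ X) ⊎ (z ≡ Y)
  layout-split (K-X-Y refl refl refl) z (l , h) with z ≤? lo + d
  ... | yes z≤ = inj₁ (l , z≤)
  ... | no z≰ with m≤n⇒m<n∨m≡n h
  ...   | inj₂ z≡Y = inj₂ (inj₂ z≡Y)
  ...   | inj₁ z<Y = inj₂ (inj₁ (≤-antisym (s≤s⁻¹ (≤-≡ z<Y (+-suc lo (suc d)))) (≡-≤ (+-suc lo d) (≰⇒> z≰))))
  layout-split (Y-K-X refl refl refl) z (l , h) with m≤n⇒m<n∨m≡n l | m≤n⇒m<n∨m≡n h
  ... | inj₂ lo≡z | _          = inj₂ (inj₂ (sym lo≡z))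
  ... | inj₁ _    | inj₂ z≡X   = inj₂ (inj₁ z≡X)
  ... | inj₁ lo<z | inj₁ z<top = inj₁ (lo<z , ≤-≡ (s≤s⁻¹ (≤-≡ z<top (+-suc lo (suc d)))) (+-suc lo d))
  layout-split (X-K-Y refl refl refl) z (l , h) with m≤n⇒m<n∨m≡n l | m≤n⇒m<n∨m≡n h
  ... | inj₂ lo≡z | _          = inj₂ (inj₁ (sym lo≡z))
  ... | inj₁ _    | inj₂ z≡Y   = inj₂ (inj₂ z≡Y)
  ... | inj₁ lo<z | inj₁ z<top = inj₁ (lo<z , ≤-≡ (s≤s⁻¹ (≤-≡ z<top (+-suc lo (suc d)))) (+-suc lo d))
  layout-split (Y-X-K refl refl refl) z (l , h) with m≤n⇒m<n∨m≡n l
  ... | inj₂ lo≡z = inj₂ (inj₂ (sym lo≡z))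
  ... | inj₁ lo<z with m≤n⇒m<n∨m≡n lo<z
  ...   | inj₂ 1+lo≡z = inj₂ (inj₁ (sym 1+lo≡z))
  ...   | inj₁ 1+lo<z = inj₁ (1+lo<z , ≤-≡ h (sym 2+lo+d≡lo+d+2))

  layout-K : Layout d lo K X Y → ∀ z → z ∈[ K ,+ d ] → z ∈[ lo ,+ suc (suc d) ]
  layout-K (K-X-Y refl _ _) z (l , h) = l , ≤-trans h (+-monoʳ-≤ lo (≤-trans (n≤1+n d) (n≤1+n _)))
  layout-K (Y-K-X _ refl _) z (l , h) = ≤-trans (n≤1+n lo) l , ≤-trans h 1+lo+d≤lo+d+2
  layout-K (X-K-Y _ refl _) z (l , h) = ≤-trans (n≤1+n lo) l , ≤-trans h 1+lo+d≤lo+d+2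
  layout-K (Y-X-K _ _ refl) z (l , h) = ≤-trans (≤-trans (n≤1+n lo) (n≤1+n _)) l , ≤-≡ h 2+lo+d≡lo+d+2

  layout-X : Layout d lo K X Y → X ∈[ lo ,+ suc (suc d) ]
  layout-X (K-X-Y _ refl _) = m≤m+n lo _ , <⇒≤ lo+d+1<lo+d+2
  layout-X (Y-K-X _ _ refl) = m≤m+n lo _ , ≤-refl
  layout-X (X-K-Y refl _ _) = ≤-refl , m≤m+n lo _
  layout-X (Y-X-K _ refl _) = n≤1+n lo , lo<lo+d+2

  layout-Y : Layout d lo K X Y → Y ∈[ lo ,+ suc (suc d) ]
  layout-Y (K-X-Y _ _ refl) = m≤m+n lo _ , ≤-refl
  layout-Y (Y-K-X refl _ _) = ≤-refl , m≤m+n lo _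
  layout-Y (X-K-Y _ _ refl) = m≤m+n lo _ , ≤-refl
  layout-Y (Y-X-K refl _ _) = ≤-refl , m≤m+n lo _

  layout-X≢Y : Layout d lo K X Y → X ≢ Y
  layout-X≢Y (K-X-Y _ refl refl) = <⇒≢ lo+d+1<lo+d+2
  layout-X≢Y (Y-K-X refl _ refl) = >⇒≢ lo<lo+d+2
  layout-X≢Y (X-K-Y refl _ refl) = <⇒≢ lo<lo+d+2
  layout-X≢Y (Y-X-K refl refl _) = >⇒≢ ≤-refl

  layout-K≢X : Layout d lo K X Y → ∀ z → z ∈[ K ,+ d ] → z ≢ X
  layout-K≢X (K-X-Y refl refl _) z (_ , h) = <⇒≢ (≤-≡ (s≤s h) (sym (+-suc lo d)))
  layout-K≢X (Y-K-X _ refl refl) z (_ , h) = <⇒≢ (≤-≡ (s≤s h) 2+lo+d≡lo+d+2)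
  layout-K≢X (X-K-Y refl refl _) z (l , _) = >⇒≢ l
  layout-K≢X (Y-X-K _ refl refl) z (l , _) = >⇒≢ l

  layout-K≢Y : Layout d lo K X Y → ∀ z → z ∈[ K ,+ d ] → z ≢ Y
  layout-K≢Y (K-X-Y refl _ refl) z (_ , h) = <⇒≢ (≤-trans (s≤s h) 1+lo+d≤lo+d+2)
  layout-K≢Y (Y-K-X refl refl _) z (l , _) = >⇒≢ l
  layout-K≢Y (X-K-Y _ refl refl) z (_ , h) = <⇒≢ (≤-≡ (s≤s h) 2+lo+d≡lo+d+2)
  layout-K≢Y (Y-X-K refl _ refl) z (l , _) = >⇒≢ (≤-trans (n≤1+n _) l)

-- Let k ≥ 2, N = 2k, and let W be a window colouring of K_N of
-- width d with span t; put R = d + 2 (the degree of K_N □ C_N).  In the copy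
-- of K_N at cycle position j the vertex (u, j) gets the colours of W shifted
-- by σ j, and the cycle edge with index j (joining positions j and j + 1
-- mod N) gets colour st u + d + 1 + η j at (u, j) and (u, j + 1):
--   σ j = R j,            η j = R j              for j < k,
--   σ j = R (N − j) + 1,  η j = R (N − j − 1) + 1  for j ≥ k.
-- The shifts go up by R along the first half of the cycle and back down along
-- the second, so at every vertex the d + 1 colours of K_N and its two cycle
-- colours tile a window of d + 3 colours (a Layout), and the colouring is an
-- interval colouring with span T = t + R k + 1.
module CycleProduct (k : ℕ) (2≤k : 2 ≤ k) {d t : ℕ} (W : WindowColouring (Fin (k + k)) d t) where
  open WindowColouring W
  open ≤-Reasoning

  N D R T : ℕ
  N = k + k
  D = suc d
  R = suc (suc d)
  T = t + R * k + 1

  σ : ℕ → ℕ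
  σ j with j <? k
  ... | yes _ = R * j
  ... | no _  = R * (N ∸ j) + 1

  η : ℕ → ℕ
  η j with j <? k
  ... | yes _ = R * j
  ... | no _  = R * (N ∸ suc j) + 1

  σ-< : ∀ {j} → j < k → σ j ≡ R * j
  σ-< {j} j<k with j <? k
  ... | yes _ = refl
  ... | no j≮k = ⊥-elim (j≮k j<k)

  σ-≥ : ∀ {j} → k ≤ j → σ j ≡ R * (N ∸ j) + 1
  σ-≥ {j} k≤j with j <? k
  ... | yes j<k = ⊥-elim (<⇒≱ j<k k≤j)
  ... | no _ = refl

  η-< : ∀ {j} → j < k → η j ≡ R * j
  η-< {j} j<k with j <? k
  ... | yes _ = refl
  ... | no j≮k = ⊥-elim (j≮k j<k)

  η-≥ : ∀ {j} → k ≤ j → η j ≡ R * (N ∸ suc j) + 1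
  η-≥ {j} k≤j with j <? k
  ... | yes j<k = ⊥-elim (<⇒≱ j<k k≤j)
  ... | no _ = refl

  prev : ℕ → ℕ
  prev zero    = pred N
  prev (suc j) = j

  -- Where the window of colours at (u, j) starts, relative to st u.
  low : ℕ → ℕ
  low zero = 0
  low (suc i) with i <? k
  ... | yes _ = R * i + D
  ... | no _  = R * (N ∸ suc i)

  data Region : ℕ → Set where
    origin  : Region 0
    rising  : ∀ i → suc i < k → Region (suc i)
    middle  : ∀ k′ → suc k′ ≡ k → Region k
    falling : ∀ e w → suc e + suc w ≡ k → Region (k + suc e)

  region : ∀ j → j < N → Region j
  region zero _ = origin
  region (suc i) j<N with suc i <? k
  ... | yes j<k = rising i j<k
  ... | no j≮k with m≤n⇒∃[o]m+o≡n (≮⇒≥ j≮k)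
  ...   | zero , k+0≡j = subst Region (trans (sym (+-identityʳ k)) k+0≡j) (middle i (trans (sym k+0≡j) (+-identityʳ k)))
  ...   | suc e , k+e≡j with m≤n⇒∃[o]m+o≡n e<k
    where
    e<k : suc (suc e) ≤ k
    e<k = +-cancelˡ-≤ k _ _ (begin
      k + suc (suc e) ≡⟨ +-suc k (suc e) ⟩
      suc (k + suc e) ≡⟨ cong suc k+e≡j ⟩
      suc (suc i)     ≤⟨ j<N ⟩
      k + k           ∎)
  ...     | w , k≡ = subst Region k+e≡j (falling e w (trans (+-suc (suc e) w) k≡))

  low-< : ∀ {i} → i < k → low (suc i) ≡ R * i + D
  low-< {i} i<k with i <? k
  ... | yes _ = refl
  ... | no i≮k = ⊥-elim (i≮k i<k)

  low-≥ : ∀ {i} → k ≤ i → low (suc i) ≡ R * (N ∸ suc i)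
  low-≥ {i} k≤i with i <? k
  ... | yes i<k = ⊥-elim (<⇒≱ i<k k≤i)
  ... | no _ = refl

  N∸[k+x] : ∀ x y → x + y ≡ k → N ∸ (k + x) ≡ y
  N∸[k+x] x y x+y≡k = trans ([m+n]∸[m+o]≡n∸o k k x) (trans (cong (_∸ x) (sym x+y≡k)) (m+n∸m≡n x y))

  0<k : 0 < k
  0<k = ≤-trans (s≤s z≤n) 2≤k

  k<N : k < N
  k<N = m<m+n k 0<k

  suc-last : suc (pred N) ≡ N
  suc-last = suc-pred′ N (<-trans 0<k k<N)
    where
    suc-pred′ : ∀ n → 0 < n → suc (pred n) ≡ n
    suc-pred′ (suc n) _ = refl

  η-last : η (pred N) ≡ 1
  η-last = begin-equality
    η (pred N)               ≡⟨ η-≥ (pred-mono-≤ k<N) ⟩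
    R * (N ∸ suc (pred N)) + 1 ≡⟨ cong (λ x → R * (N ∸ x) + 1) suc-last ⟩
    R * (N ∸ N) + 1          ≡⟨ cong (λ x → R * x + 1) (n∸n≡0 N) ⟩
    R * 0 + 1                ≡⟨ cong (_+ 1) (*-zeroʳ R) ⟩
    1                        ∎

  σ-middle : ∀ k′ → suc k′ ≡ k → σ (suc k′) ≡ R * suc k′ + 1
  σ-middle k′ k′+1≡k = begin-equality
    σ (suc k′)               ≡⟨ σ-≥ (≤-reflexive (sym k′+1≡k)) ⟩
    R * (N ∸ suc k′) + 1     ≡⟨ cong (λ x → R * (N ∸ x) + 1) k′+1≡k ⟩
    R * (N ∸ k) + 1          ≡⟨ cong (λ x → R * x + 1) (trans (m+n∸m≡n k k) (sym k′+1≡k)) ⟩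
    R * suc k′ + 1           ∎

  η-middle : ∀ k′ → suc k′ ≡ k → η (suc k′) ≡ R * k′ + 1
  η-middle k′ k′+1≡k = begin-equality
    η (suc k′)                 ≡⟨ η-≥ (≤-reflexive (sym k′+1≡k)) ⟩
    R * (N ∸ suc (suc k′)) + 1 ≡⟨ cong (λ x → R * (N ∸ suc x) + 1) k′+1≡k ⟩
    R * (N ∸ suc k) + 1        ≡⟨ cong (λ x → R * (N ∸ x) + 1) (+-comm 1 k) ⟩
    R * (N ∸ (k + 1)) + 1      ≡⟨ cong (λ x → R * x + 1) (N∸[k+x] 1 k′ k′+1≡k) ⟩
    R * k′ + 1                 ∎

  falling-dist : ∀ e w → suc e + suc w ≡ k → N ∸ suc (k + e) ≡ suc w
  falling-dist e w e+w≡k = trans (cong (N ∸_) (sym (+-suc k e))) (N∸[k+x] (suc e) (suc w) e+w≡k)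

  falling-dist′ : ∀ e w → suc e + suc w ≡ k → N ∸ suc (suc (k + e)) ≡ w
  falling-dist′ e w e+w≡k = begin-equality
    N ∸ suc (suc (k + e)) ≡⟨ cong (λ x → N ∸ suc x) (+-suc k e) ⟨
    N ∸ suc (k + suc e)   ≡⟨ cong (N ∸_) (+-suc k (suc e)) ⟨
    N ∸ (k + suc (suc e)) ≡⟨ N∸[k+x] (suc (suc e)) w (trans (sym (+-suc (suc e) w)) e+w≡k) ⟩
    w                     ∎

  -- At (u, j), with a = st u, the colours of K_N and of the two cycle edges
  -- tile the window starting at a + low j.  In each region we evaluate the
  -- offsets; what remains is ring arithmetic.
  Fits : ℕ → ℕ → Set
  Fits a j = Layout d (a + low j) (a + σ j) (a + D + η j) (a + D + η (prev j))

  layout : ∀ a {j} → Region j → Fits a j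
  layout a origin rewrite σ-< 0<k | η-< 0<k | η-last | *-zeroʳ R =
    K-X-Y refl (identityˣ a d) (identityʸ a d)
    where
    identityˣ : ∀ a d → a + suc d + 0 ≡ a + 0 + suc d
    identityˣ = solve-∀
    identityʸ : ∀ a d → a + suc d + 1 ≡ a + 0 + suc (suc d)
    identityʸ = solve-∀
  layout a (rising i i+1<k)
    rewrite low-< (<-trans (n<1+n i) i+1<k) | σ-< i+1<k | η-< i+1<k | η-< (<-trans (n<1+n i) i+1<k) =
    Y-K-X (identityʸ a d i) (identityᴷ a d i) (identityˣ a d i)
    where
    identityʸ : ∀ a d i → a + suc d + suc (suc d) * i ≡ a + (suc (suc d) * i + suc d)
    identityʸ = solve-∀
    identityᴷ : ∀ a d i → a + suc (suc d) * suc i ≡ suc (a + (suc (suc d) * i + suc d))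
    identityᴷ = solve-∀
    identityˣ : ∀ a d i → a + suc d + suc (suc d) * suc i ≡ a + (suc (suc d) * i + suc d) + suc (suc d)
    identityˣ = solve-∀
  layout a (middle k′ k′+1≡k) = subst (Fits a) k′+1≡k fits
    where
    fits : Fits a (suc k′)
    fits rewrite low-< (≤-reflexive k′+1≡k) | σ-middle k′ k′+1≡k | η-middle k′ k′+1≡k | η-< (≤-reflexive k′+1≡k) =
      Y-X-K (identityʸ a d k′) (identityˣ a d k′) (identityᴷ a d k′)
      where
      identityʸ : ∀ a d k → a + suc d + suc (suc d) * k ≡ a + (suc (suc d) * k + suc d)
      identityʸ = solve-∀
      identityˣ : ∀ a d k → a + suc d + (suc (suc d) * k + 1) ≡ suc (a + (suc (suc d) * k + suc d))
      identityˣ = solve-∀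
      identityᴷ : ∀ a d k → a + (suc (suc d) * suc k + 1) ≡ suc (suc (a + (suc (suc d) * k + suc d)))
      identityᴷ = solve-∀
  layout a (falling e w e+w≡k)
    rewrite +-suc k e | low-≥ (m≤m+n k e) | σ-≥ (m≤n⇒m≤1+n (m≤m+n k e)) | η-≥ (m≤n⇒m≤1+n (m≤m+n k e))
          | η-≥ (m≤m+n k e) | falling-dist e w e+w≡k | falling-dist′ e w e+w≡k =
    X-K-Y (identityˣ a d w) (identityᴷ a d w) (identityʸ a d w)
    where
    identityˣ : ∀ a d w → a + suc d + (suc (suc d) * w + 1) ≡ a + suc (suc d) * suc w
    identityˣ = solve-∀
    identityᴷ : ∀ a d w → a + (suc (suc d) * suc w + 1) ≡ suc (a + suc (suc d) * suc w)
    identityᴷ = solve-∀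
    identityʸ : ∀ a d w → a + suc d + (suc (suc d) * suc w + 1) ≡ a + suc (suc d) * suc w + suc (suc d)
    identityʸ = solve-∀

  R*i+D<R*[1+i] : ∀ i → R * i + D < R * suc i
  R*i+D<R*[1+i] i = begin-strict
    R * i + D   <⟨ +-monoʳ-< (R * i) ≤-refl ⟩
    R * i + R   ≡⟨ +-comm (R * i) R ⟩
    R + R * i   ≡⟨ *-suc R i ⟨
    R * suc i   ∎

  low<R*k : ∀ {j} → Region j → low j < R * k
  low<R*k origin = ≤-trans (s≤s z≤n) (≡-≤ (sym (*-identityʳ R)) (*-monoʳ-≤ R 0<k))
  low<R*k (rising i i+1<k) rewrite low-< (<-trans (n<1+n i) i+1<k) =
    ≤-trans (R*i+D<R*[1+i] i) (*-monoʳ-≤ R (<⇒≤ i+1<k))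
  low<R*k (middle k′ k′+1≡k) = subst (λ j → low j < R * k) k′+1≡k (begin-strict
    low (suc k′)  ≡⟨ low-< (≤-reflexive k′+1≡k) ⟩
    R * k′ + D    <⟨ R*i+D<R*[1+i] k′ ⟩
    R * suc k′    ≡⟨ cong (R *_) k′+1≡k ⟩
    R * k         ∎)
  low<R*k (falling e w e+w≡k) rewrite +-suc k e | low-≥ (m≤m+n k e) | falling-dist e w e+w≡k =
    *-monoʳ-< R (≤-≡ (s≤s (m≤n+m (suc w) e)) e+w≡k)

  fits-in : ∀ a {j} → a + d ≤ t → Region j → a + low j + R ≤ T
  fits-in a {j} a+d≤t r = begin
    a + low j + R             ≡⟨ identity a (low j) d ⟩
    a + d + suc (low j) + 1   ≤⟨ +-monoˡ-≤ 1 (+-mono-≤ a+d≤t (low<R*k r)) ⟩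
    T                         ∎
    where
    identity : ∀ a l d → a + l + suc (suc d) ≡ a + d + suc l + 1
    identity = solve-∀

  next : Fin N → Fin N
  next j with suc (toℕ j) ≟ N
  ... | yes _   = fromℕ< (<-trans 0<k k<N)
  ... | no j+1≢N = fromℕ< (≤∧≢⇒< (toℕ<n j) j+1≢N)

  next-step : ∀ j → CycleStep N j (next j)
  next-step j with suc (toℕ j) ≟ N
  ... | yes j+1≡N = inj₂ (j+1≡N , toℕ-fromℕ< _)
  ... | no _      = inj₁ (sym (toℕ-fromℕ< _))

  next-unique : ∀ j j₂ → CycleStep N j j₂ → j₂ ≡ next j
  next-unique j j₂ step with suc (toℕ j) ≟ N | step
  ... | yes j+1≡N | inj₁ j+1≡j₂    = ⊥-elim (<⇒≢ (toℕ<n j₂) (trans (sym j+1≡j₂) j+1≡N))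
  ... | yes _     | inj₂ (_ , j₂≡0) = toℕ-injective (trans j₂≡0 (sym (toℕ-fromℕ< _)))
  ... | no _      | inj₁ j+1≡j₂    = toℕ-injective (trans (sym j+1≡j₂) (sym (toℕ-fromℕ< _)))
  ... | no j+1≢N  | inj₂ (j+1≡N , _) = ⊥-elim (j+1≢N j+1≡N)

  prev<N : ∀ j → j < N → prev j < N
  prev<N zero    _   = ≤-≡ (≤-refl) suc-last
  prev<N (suc j) j<N = <-trans (n<1+n j) j<N

  before : Fin N → Fin N
  before j = fromℕ< (prev<N (toℕ j) (toℕ<n j))

  before-step : ∀ j → CycleStep N (before j) j
  before-step j rewrite toℕ-fromℕ< (prev<N (toℕ j) (toℕ<n j)) = step (toℕ j)
    where
    step : ∀ x → (suc (prev x) ≡ x) ⊎ ((suc (prev x) ≡ N) × (x ≡ 0))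
    step zero    = inj₂ (suc-last , refl)
    step (suc x) = inj₁ refl

  before-unique : ∀ j j₂ → CycleStep N j₂ j → j₂ ≡ before j
  before-unique j j₂ (inj₁ j₂+1≡j) =
    toℕ-injective (trans (cong prev j₂+1≡j) (sym (toℕ-fromℕ< _)))
  before-unique j j₂ (inj₂ (j₂+1≡N , j≡0)) =
    toℕ-injective (trans (cong pred j₂+1≡N) (trans (cong prev (sym j≡0)) (sym (toℕ-fromℕ< _))))

  -- N ≥ 4 rules out steps from a position to itself and 2-cycles.
  N≢1 : 1 ≢ N
  N≢1 = <⇒≢ (≤-trans (s≤s 0<k) k<N)

  N≢2 : 2 ≢ N
  N≢2 = <⇒≢ (≤-trans (s≤s 2≤k) k<N)

  step≢ : ∀ j j₂ → CycleStep N j j₂ → j ≢ j₂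
  step≢ j j₂ (inj₁ j+1≡j₂) refl = <⇒≢ (n<1+n _) (sym j+1≡j₂)
  step≢ j j₂ (inj₂ (j+1≡N , j₂≡0)) refl = N≢1 (trans (cong suc (sym j₂≡0)) j+1≡N)

  adjacent≢ : ∀ j j₂ → Adj (C N) j j₂ → j ≢ j₂
  adjacent≢ j j₂ (inj₁ step) = step≢ j j₂ step
  adjacent≢ j j₂ (inj₂ step) = ≢-sym (step≢ j₂ j step)

  -- The index of the cycle edge between positions x and y: x if y = x + 1,
  -- and N − 1 for the closing edge between N − 1 and 0.
  index : ℕ → ℕ → ℕ
  index x y with suc x ≟ y
  ... | yes _ = x
  ... | no _ with suc y ≟ x
  ...   | yes _ = y
  ...   | no _  = pred N

  index-up : ∀ {x y} → suc x ≡ y → index x y ≡ x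
  index-up {x} {y} x+1≡y with suc x ≟ y
  ... | yes _ = refl
  ... | no x+1≢y = ⊥-elim (x+1≢y x+1≡y)

  index-down : ∀ {x y} → suc y ≡ x → index x y ≡ y
  index-down {x} {y} y+1≡x with suc x ≟ y
  ... | yes x+1≡y = ⊥-elim (<⇒≢ (≤-trans (n<1+n y) (n≤1+n _)) (sym (trans (cong suc y+1≡x) x+1≡y)))
  ... | no _ with suc y ≟ x
  ...   | yes _ = refl
  ...   | no y+1≢x = ⊥-elim (y+1≢x y+1≡x)

  index-closing : ∀ {x y} → suc x ≢ y → suc y ≢ x → index x y ≡ pred N
  index-closing {x} {y} x+1≢y y+1≢x with suc x ≟ y
  ... | yes x+1≡y = ⊥-elim (x+1≢y x+1≡y)
  ... | no _ with suc y ≟ x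
  ...   | yes y+1≡x = ⊥-elim (y+1≢x y+1≡x)
  ...   | no _ = refl

  index-sym : ∀ x y → index x y ≡ index y x
  index-sym x y = by-cases (suc x ≟ y) (suc y ≟ x)
    where
    by-cases : Dec (suc x ≡ y) → Dec (suc y ≡ x) → index x y ≡ index y x
    by-cases (yes x+1≡y) _          = trans (index-up x+1≡y) (sym (index-down x+1≡y))
    by-cases (no _)      (yes y+1≡x) = trans (index-down y+1≡x) (sym (index-up y+1≡x))
    by-cases (no x+1≢y)  (no y+1≢x)  = trans (index-closing x+1≢y y+1≢x) (sym (index-closing y+1≢x x+1≢y))

  index-next : ∀ j j₂ → CycleStep N j j₂ → index (toℕ j) (toℕ j₂) ≡ toℕ j
  index-next j j₂ (inj₁ j+1≡j₂) = index-up j+1≡j₂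
  index-next j j₂ (inj₂ (j+1≡N , j₂≡0)) = trans (index-closing j+1≢j₂ j₂+1≢j) (cong pred (sym j+1≡N))
    where
    j+1≢j₂ : suc (toℕ j) ≢ toℕ j₂
    j+1≢j₂ e = 1+n≢0 (trans e j₂≡0)
    j₂+1≢j : suc (toℕ j₂) ≢ toℕ j
    j₂+1≢j e = N≢2 (trans (cong (λ x → suc (suc x)) (sym j₂≡0)) (trans (cong suc e) j+1≡N))

  index-prev : ∀ j j₂ → CycleStep N j₂ j → index (toℕ j) (toℕ j₂) ≡ prev (toℕ j)
  index-prev j j₂ (inj₁ j₂+1≡j) = trans (index-down j₂+1≡j) (cong prev j₂+1≡j)
  index-prev j j₂ (inj₂ (j₂+1≡N , j≡0)) = trans (index-closing j+1≢j₂ j₂+1≢j) (cong prev (sym j≡0))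
    where
    j+1≢j₂ : suc (toℕ j) ≢ toℕ j₂
    j+1≢j₂ e = N≢2 (trans (cong (λ x → suc (suc x)) (sym j≡0)) (trans (cong suc e) j₂+1≡N))
    j₂+1≢j : suc (toℕ j₂) ≢ toℕ j
    j₂+1≢j e = 1+n≢0 (trans e j≡0)

  G : Graph
  G = K N □ C N

  colour : V G → V G → ℕ
  colour (u , j) (u₂ , j₂) with j ≟ᶠ j₂
  ... | yes _ = col u u₂ + σ (toℕ j)
  ... | no _  = st u + D + η (index (toℕ j) (toℕ j₂))

  colour-K : ∀ (u u₂ j : Fin N) → colour (u , j) (u₂ , j) ≡ col u u₂ + σ (toℕ j)
  colour-K u u₂ j with j ≟ᶠ j
  ... | yes _ = refl
  ... | no j≢j = ⊥-elim (j≢j refl)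

  colour-C : ∀ (u j j₂ : Fin N) → j ≢ j₂ → colour (u , j) (u , j₂) ≡ st u + D + η (index (toℕ j) (toℕ j₂))
  colour-C u j j₂ j≢j₂ with j ≟ᶠ j₂
  ... | yes j≡j₂ = ⊥-elim (j≢j₂ j≡j₂)
  ... | no _ = refl

  lo : Fin N → Fin N → ℕ
  lo u j = st u + low (toℕ j)

  fits : ∀ (u j : Fin N) → Fits (st u) (toℕ j)
  fits u j = layout (st u) (region (toℕ j) (toℕ<n j))

  colour-K∈ : ∀ (u u₂ j : Fin N) → u ≢ u₂ → col u u₂ + σ (toℕ j) ∈[ st u + σ (toℕ j) ,+ d ]
  colour-K∈ u u₂ j u≢u₂ = +-monoˡ-≤ (σ (toℕ j)) (col≥st u u₂ u≢u₂) , (begin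
    col u u₂ + σ (toℕ j)     ≤⟨ +-monoˡ-≤ (σ (toℕ j)) (col≤st+d u u₂ u≢u₂) ⟩
    st u + d + σ (toℕ j)     ≡⟨ +-assoc (st u) d _ ⟩
    st u + (d + σ (toℕ j))   ≡⟨ cong (st u +_) (+-comm d _) ⟩
    st u + (σ (toℕ j) + d)   ≡⟨ +-assoc (st u) _ d ⟨
    st u + σ (toℕ j) + d     ∎)

  colour-next : ∀ (u j j₂ : Fin N) → CycleStep N j j₂ → colour (u , j) (u , j₂) ≡ st u + D + η (toℕ j)
  colour-next u j j₂ step = trans (colour-C u j j₂ (step≢ j j₂ step)) (cong (λ x → st u + D + η x) (index-next j j₂ step))

  colour-prev : ∀ (u j j₂ : Fin N) → CycleStep N j₂ j → colour (u , j) (u , j₂) ≡ st u + D + η (prev (toℕ j))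
  colour-prev u j j₂ step = trans (colour-C u j j₂ (≢-sym (step≢ j₂ j step))) (cong (λ x → st u + D + η x) (index-prev j j₂ step))

  colour∈ : ∀ (u j : Fin N) w → Adj G (u , j) w → colour (u , j) w ∈[ lo u j ,+ R ]
  colour∈ u j (u₂ , .j) (inj₂ (refl , u≢u₂)) =
    subst (λ c → c ∈[ lo u j ,+ R ]) (sym (colour-K u u₂ j)) (layout-K (fits u j) _ (colour-K∈ u u₂ j u≢u₂))
  colour∈ u j (.u , j₂) (inj₁ (refl , inj₁ step)) =
    subst (λ c → c ∈[ lo u j ,+ R ]) (sym (colour-next u j j₂ step)) (layout-X (fits u j))
  colour∈ u j (.u , j₂) (inj₁ (refl , inj₂ step)) =
    subst (λ c → c ∈[ lo u j ,+ R ]) (sym (colour-prev u j j₂ step)) (layout-Y (fits u j))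

  Seen : V G → ℕ → Set
  Seen v z = Σ (V G) λ w → Adj G v w × (colour v w ≡ z)

  window-onto : ∀ (u j : Fin N) z → z ∈[ lo u j ,+ R ] → Seen (u , j) z
  window-onto u j z z∈ with layout-split (fits u j) z z∈
  ... | inj₂ (inj₁ z≡X) = (u , next j) , inj₁ (refl , inj₁ (next-step j)) ,
                          trans (colour-next u j (next j) (next-step j)) (sym z≡X)
  ... | inj₂ (inj₂ z≡Y) = (u , before j) , inj₁ (refl , inj₂ (before-step j)) ,
                          trans (colour-prev u j (before j) (before-step j)) (sym z≡Y)
  ... | inj₁ (l , h) with onto u (z ∸ σ (toℕ j)) (m+n≤o⇒m≤o∸n (st u) l) (m≤n+o⇒m∸n≤o z (σ (toℕ j)) (≤-≡ h (identity (st u) (σ (toℕ j)) d)))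
    where
    identity : ∀ a s d → a + s + d ≡ s + (a + d)
    identity = solve-∀
  ...   | u₂ , u≢u₂ , col≡ = (u₂ , j) , inj₂ (refl , u≢u₂) , (begin-equality
    colour (u , j) (u₂ , j)  ≡⟨ colour-K u u₂ j ⟩
    col u u₂ + σ (toℕ j)     ≡⟨ cong (_+ σ (toℕ j)) col≡ ⟩
    z ∸ σ (toℕ j) + σ (toℕ j) ≡⟨ m∸n+n≡m (≤-trans (m≤n+m _ (st u)) l) ⟩
    z                        ∎)

  colour-sym : ∀ v w → Adj G v w → colour v w ≡ colour w v
  colour-sym (u , j) (u₂ , .j) (inj₂ (refl , u≢u₂)) = begin-equality
    colour (u , j) (u₂ , j) ≡⟨ colour-K u u₂ j ⟩
    col u u₂ + σ (toℕ j)    ≡⟨ cong (_+ σ (toℕ j)) (col-sym u u₂ u≢u₂) ⟩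
    col u₂ u + σ (toℕ j)    ≡⟨ colour-K u₂ u j ⟨
    colour (u₂ , j) (u , j) ∎
  colour-sym (u , j) (.u , j₂) (inj₁ (refl , adj)) = begin-equality
    colour (u , j) (u , j₂)                 ≡⟨ colour-C u j j₂ j≢j₂ ⟩
    st u + D + η (index (toℕ j) (toℕ j₂))   ≡⟨ cong (λ x → st u + D + η x) (index-sym (toℕ j) (toℕ j₂)) ⟩
    st u + D + η (index (toℕ j₂) (toℕ j))   ≡⟨ colour-C u j₂ j (≢-sym j≢j₂) ⟨
    colour (u , j₂) (u , j)                 ∎
    where
    j≢j₂ : j ≢ j₂
    j≢j₂ = adjacent≢ j j₂ adj

  colour-range : ∀ v w → Adj G v w → (1 ≤ colour v w) × (colour v w ≤ T)
  colour-range (u , j) w adj with colour∈ u j w adj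
  ... | l , h = ≤-trans (≤-trans (st≥1 u) (m≤m+n (st u) _)) l ,
                ≤-trans h (fits-in (st u) (st+d≤t u) (region (toℕ j) (toℕ<n j)))

  -- Properness: colours of K-edges at (u, j) are distinct because W is
  -- proper, the two cycle colours are distinct by the layout, and the
  -- layout keeps the cycle colours outside the K-window.
  colour-proper : ∀ v w w′ → Adj G v w → Adj G v w′ → colour v w ≡ colour v w′ → w ≡ w′
  colour-proper (u , j) (u₂ , .j) (u₃ , .j) (inj₂ (refl , u≢u₂)) (inj₂ (refl , u≢u₃)) e =
    cong (_, j) (proper u u₂ u₃ u≢u₂ u≢u₃ (+-cancelʳ-≡ (σ (toℕ j)) _ _ (trans (sym (colour-K u u₂ j)) (trans e (colour-K u u₃ j)))))
  colour-proper (u , j) (u₂ , .j) (.u , j₃) (inj₂ (refl , u≢u₂)) (inj₁ (refl , inj₁ step)) e =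
    ⊥-elim (layout-K≢X (fits u j) _ (colour-K∈ u u₂ j u≢u₂) (trans (sym (colour-K u u₂ j)) (trans e (colour-next u j j₃ step))))
  colour-proper (u , j) (u₂ , .j) (.u , j₃) (inj₂ (refl , u≢u₂)) (inj₁ (refl , inj₂ step)) e =
    ⊥-elim (layout-K≢Y (fits u j) _ (colour-K∈ u u₂ j u≢u₂) (trans (sym (colour-K u u₂ j)) (trans e (colour-prev u j j₃ step))))
  colour-proper (u , j) (.u , j₂) (u₃ , .j) (inj₁ (refl , inj₁ step)) (inj₂ (refl , u≢u₃)) e =
    ⊥-elim (layout-K≢X (fits u j) _ (colour-K∈ u u₃ j u≢u₃) (trans (sym (colour-K u u₃ j)) (trans (sym e) (colour-next u j j₂ step))))
  colour-proper (u , j) (.u , j₂) (u₃ , .j) (inj₁ (refl , inj₂ step)) (inj₂ (refl , u≢u₃)) e =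
    ⊥-elim (layout-K≢Y (fits u j) _ (colour-K∈ u u₃ j u≢u₃) (trans (sym (colour-K u u₃ j)) (trans (sym e) (colour-prev u j j₂ step))))
  colour-proper (u , j) (.u , j₂) (.u , j₃) (inj₁ (refl , inj₁ step₂)) (inj₁ (refl , inj₁ step₃)) _ =
    cong (u ,_) (trans (next-unique j j₂ step₂) (sym (next-unique j j₃ step₃)))
  colour-proper (u , j) (.u , j₂) (.u , j₃) (inj₁ (refl , inj₂ step₂)) (inj₁ (refl , inj₂ step₃)) _ =
    cong (u ,_) (trans (before-unique j j₂ step₂) (sym (before-unique j j₃ step₃)))
  colour-proper (u , j) (.u , j₂) (.u , j₃) (inj₁ (refl , inj₁ step₂)) (inj₁ (refl , inj₂ step₃)) e =
    ⊥-elim (layout-X≢Y (fits u j) (trans (sym (colour-next u j j₂ step₂)) (trans e (colour-prev u j j₃ step₃))))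
  colour-proper (u , j) (.u , j₂) (.u , j₃) (inj₁ (refl , inj₂ step₂)) (inj₁ (refl , inj₁ step₃)) e =
    ⊥-elim (layout-X≢Y (fits u j) (trans (sym (colour-next u j j₃ step₃)) (trans (sym e) (colour-prev u j j₂ step₂))))

  colour-interval : ∀ v → ∃[ x ] ∃[ y ] (∀ z → Seen v z ⇔ ((x ≤ z) × (z ≤ y)))
  colour-interval (u , j) = lo u j , lo u j + R , λ z → mk⇔
    (λ { (w , adj , refl) → colour∈ u j w adj })
    (window-onto u j z)

  -- The copy of W at position i < N, whose
  -- windows are shifted by low i, uses all of [low i + 1, low i + t + 2]; and
  -- along positions 0, 1, …, k these bands overlap and reach up to T.
  Used : ℕ → Set
  Used z = Σ (V G) λ v → Seen v z

  band : ∀ i → i < N → ∀ z → low i + 1 ≤ z → z ≤ low i + (t + 2) → Used z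
  band i i<N z l h with m≤n⇒∃[o]m+o≡n (≤-trans (m≤m+n (low i) 1) l)
  ... | y , low+y≡z with covers⁺ y 1≤y y≤t+2
    where
    1≤y : 1 ≤ y
    1≤y = +-cancelˡ-≤ (low i) 1 y (≤-≡ l (sym low+y≡z))
    y≤t+2 : y ≤ t + 2
    y≤t+2 = +-cancelˡ-≤ (low i) y (t + 2) (≡-≤ low+y≡z h)
  ...   | u , st≤y , y≤ = (u , j) , window-onto u j z (z∈ st≤y , z≤ y≤)
    where
    j : Fin N
    j = fromℕ< i<N
    lo≡ : lo u j ≡ st u + low i
    lo≡ = cong (λ x → st u + low x) (toℕ-fromℕ< i<N)
    z∈ : st u ≤ y → lo u j ≤ z
    z∈ p = ≡-≤ (trans lo≡ (+-comm (st u) (low i))) (≤-≡ (+-monoʳ-≤ (low i) p) low+y≡z)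
    z≤ : y ≤ st u + R → z ≤ lo u j + R
    z≤ p = ≤-≡ (≡-≤ (sym low+y≡z) (+-monoʳ-≤ (low i) p)) (trans (identity (low i) (st u) R) (cong (_+ R) (sym lo≡)))
      where
      identity : ∀ l a r → l + (a + r) ≡ a + l + r
      identity = solve-∀

  d≤t : d ≤ t
  d≤t = m+n≤o⇒n≤o (st (proj₁ bottom)) (st+d≤t (proj₁ bottom))

  low-step : ∀ i → i < k → low (suc i) ≤ low i + (t + 2)
  low-step zero 0<k′ rewrite low-< 0<k′ | *-zeroʳ R = ≤-trans (s≤s d≤t) (≤-≡ (n≤1+n (suc t)) (+-comm 2 t))
  low-step (suc i) i+1<k rewrite low-< i+1<k | low-< (<-trans (n<1+n i) i+1<k) = begin
    R * suc i + D         ≡⟨ cong (_+ D) (*-suc R i) ⟩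
    R + R * i + D         ≡⟨ identity (R * i) d ⟩
    R * i + D + (d + 2)   ≤⟨ +-monoʳ-≤ (R * i + D) (+-monoˡ-≤ 2 d≤t) ⟩
    R * i + D + (t + 2)   ∎
    where
    identity : ∀ x d → suc (suc d) + x + suc d ≡ x + suc d + (d + 2)
    identity = solve-∀

  covered-upto : ∀ i → i ≤ k → ∀ z → 1 ≤ z → z ≤ low i + (t + 2) → Used z
  covered-upto zero _ z l h = band zero (<-trans 0<k k<N) z l h
  covered-upto (suc i) i+1≤k z l h with z ≤? low i + (t + 2)
  ... | yes z≤ = covered-upto i (≤-trans (n≤1+n i) i+1≤k) z l z≤
  ... | no z≰ = band (suc i) (≤-<-trans i+1≤k k<N) z (≤-trans (+-monoˡ-≤ 1 (low-step i i+1≤k)) (≡-≤ (+-comm _ 1) (≰⇒> z≰))) h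

  T≤low-k : T ≤ low k + (t + 2)
  T≤low-k with m≤n⇒∃[o]m+o≡n 0<k
  ... | k′ , k′+1≡k = begin
    t + R * k + 1          ≡⟨ cong (λ x → t + R * x + 1) k′+1≡k ⟨
    t + R * suc k′ + 1     ≡⟨ identity t d k′ ⟩
    R * k′ + D + (t + 2)   ≡⟨ cong (_+ (t + 2)) (low-< (≤-reflexive k′+1≡k)) ⟨
    low (suc k′) + (t + 2) ≡⟨ cong (λ x → low x + (t + 2)) k′+1≡k ⟩
    low k + (t + 2)        ∎
    where
    identity : ∀ t d k → t + suc (suc d) * suc k + 1 ≡ suc (suc d) * k + suc d + (t + 2)
    identity = solve-∀

  colour-onto : ∀ z → 1 ≤ z → z ≤ T → Used z
  colour-onto z l h = covered-upto k ≤-refl z l (≤-trans h T≤low-k)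

  product-colouring : IntervalColoring G T
  product-colouring = colour , colour-sym , colour-range , colour-onto , colour-proper , colour-interval

final-bound : ∀ n t p q → 4 * n ≤ t + p + q + 2 → 2 * n * n + 4 * n ∸ 1 ∸ p ∸ q ≤ t + (n + n) * n + 1
final-bound n t p q span =
  m≤n+o⇒m∸n≤o (2 * n * n + 4 * n ∸ 1 ∸ p) q
    (m≤n+o⇒m∸n≤o (2 * n * n + 4 * n ∸ 1) p
      (m≤n+o⇒m∸n≤o (2 * n * n + 4 * n) 1 (begin
        2 * n * n + 4 * n               ≤⟨ +-monoʳ-≤ (2 * n * n) span ⟩
        2 * n * n + (t + p + q + 2)     ≡⟨ identity n t p q ⟩
        1 + (p + (q + (t + (n + n) * n + 1))) ∎)))
  where
  open ≤-Reasoning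
  identity : ∀ n t p q → 2 * n * n + (t + p + q + 2) ≡ 1 + (p + (q + (t + (n + n) * n + 1)))
  identity = solve-∀

-- Corollary 2.
corollary2 : (n p q : ℕ) → 2 ≤ n → Odd p → n ≡ p * 2 ^ q →
    IntervalColorable (K (2 * n) □ C (2 * n))
    × W≥ (K (2 * n) □ C (2 * n)) (2 * n * n + 4 * n ∸ 1 ∸ p ∸ q)
corollary2 n p q 2≤n (_ , p≡2h+1) n≡p2^q = (T , 1≤T , coloured) , (T , bound , coloured)
  where
  1≤p : 1 ≤ p
  1≤p = ≤-≡ (s≤s z≤n) (sym p≡2h+1)
  open Large (subst (λ m → Large m p q) (sym n≡p2^q) (large p q 1≤p))
  open CycleProduct n 2≤n colouring using (T; product-colouring)
  coloured : IntervalColoring (K (2 * n) □ C (2 * n)) T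
  coloured = subst (λ M → IntervalColoring (K M □ C M) T) (cong (n +_) (sym (+-identityʳ n))) product-colouring
  1≤T : 1 ≤ T
  1≤T = m≤n+m 1 _
  bound : 2 * n * n + 4 * n ∸ 1 ∸ p ∸ q ≤ T
  bound = ≤-≡ (final-bound n t p q span) (cong (λ r → t + r * n + 1) (sym width))
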